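{- For any odd prime $p$ and integers $n,d\ge 1$, \[ \delta_{n,p}(d) \le e^{1/3}\exp\left(-\frac{n}{(d^2+d)p^{d^2}}\right). \]
   Context: $\mathbb{F}_p[x]_m$ is the set of monic polynomials in $\mathbb{F}_p[x]$. For $u\in\mathbb{F}_p[x]_m$ and $\alpha\in\mathbb{F}_p[x]/(u)$, $\mathcal{A}_n(u;\alpha) = \{(a_1,\ldots,a_n)\in(\mathbb{F}_p\setminus\{0\})^n : a_1x^{n-1}+\cdots+a_n\equiv\alpha\bmod u\}$, and $\delta_{n,p}(d) = \max_{u\in\mathbb{F}_p[x]_m,\ \deg u=d,\ x\nmid u}\ \max_{\alpha\in\mathbb{F}_p[x]/(u)}\left|\frac{|\mathcal{A}_n(u;\alpha)|}{(p-1)^n} - p^{ -d}\right|$. -}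

module Defs where

open import Data.Nat as ℕ using (ℕ; zero; suc; _+_; _*_; _∸_; _^_; _%_)
open import Data.Integer using (+_)
open import Data.List using (List; []; _∷_; map; concatMap; foldl; foldr; filter; length; replicate; upTo; zipWith)
open import Data.List.Properties using (≡-dec)
open import Data.Product using (∃-syntax)
open import Data.Rational using (ℚ; 0ℚ; 1ℚ; _/_; ∣_∣; _⊔_; _-_; _≤_; _<_)
import Data.Rational as Q

-- reduction mod p (p = 0 never occurs in use; then identity)
modp : ℕ → ℕ → ℕ
modp zero    x = x
modp (suc k) x = x % suc k

-- the rational number n / m (m = 0 never occurs in use; then 0)
natRatio : ℕ → ℕ → ℚ
natRatio n zero    = 0ℚ
natRatio n (suc k) = (+ n) / suc k

-- ===== Polynomials =====
-- A monic u of degree d is represented by its lower coefficients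
-- c = [c_0, ..., c_{d-1}], u = x^d + c_{d-1} x^{d-1} + ... + c_0.
-- A residue class in F_p[x]/(u) is represented by its unique
-- representative of degree < d: r = [r_0, ..., r_{d-1}] (r_i < p).

lastOr0 : List ℕ → ℕ
lastOr0 []           = 0
lastOr0 (x ∷ [])     = x
lastOr0 (x ∷ y ∷ ys) = lastOr0 (y ∷ ys)

dropLast : List ℕ → List ℕ
dropLast []           = []
dropLast (x ∷ [])     = []
dropLast (x ∷ y ∷ ys) = x ∷ dropLast (y ∷ ys)

-- r ↦ x·r mod u   (uses x^d ≡ -(c_{d-1}x^{d-1}+...+c_0) mod u)
mulX : ℕ → List ℕ → List ℕ → List ℕ
mulX p c r = zipWith (λ s ci → modp p (s + (p ∸ 1) * (lastOr0 r * ci))) (0 ∷ dropLast r) c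

addConst : ℕ → ℕ → List ℕ → List ℕ
addConst p a []       = []
addConst p a (r ∷ rs) = modp p (r + a) ∷ rs

-- reduced representative of a_1 x^{n-1} + ... + a_n mod u (Horner),
-- for as = [a_1, ..., a_n]
remPoly : ℕ → List ℕ → List ℕ → List ℕ
remPoly p c as = foldl (λ r a → addConst p a (mulX p c r)) (replicate (length c) 0) as

tuples : List ℕ → ℕ → List (List ℕ)
tuples xs zero    = [] ∷ []
tuples xs (suc n) = concatMap (λ x → map (x ∷_) (tuples xs n)) xs

elems : ℕ → List ℕ
elems p = upTo p

nonzeros : ℕ → List ℕ
nonzeros p = map suc (upTo (p ∸ 1))

-- monic u of degree d with x ∤ u, i.e. c_0 ≠ 0
monicNotDivX : ℕ → ℕ → List (List ℕ)
monicNotDivX p zero    = [] ∷ []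
monicNotDivX p (suc d) = concatMap (λ c0 → map (c0 ∷_) (tuples (elems p) d)) (nonzeros p)

residues : ℕ → ℕ → List (List ℕ)
residues p d = tuples (elems p) d

countA : ℕ → ℕ → List ℕ → List ℕ → ℕ
countA p n c α = length (filter (λ as → ≡-dec ℕ._≟_ (remPoly p c as) α) (tuples (nonzeros p) n))

discrepancy : ℕ → ℕ → ℕ → List ℕ → List ℕ → ℚ
discrepancy p n d c α = ∣ natRatio (countA p n c α) ((p ∸ 1) ^ n) - natRatio 1 (p ^ d) ∣

maxℚ : List ℚ → ℚ
maxℚ = foldr _⊔_ 0ℚ

δ : ℕ → ℕ → ℕ → ℚ
δ p n d = maxℚ (concatMap (λ c → map (discrepancy p n d c) (residues p d)) (monicNotDivX p d))

-- Σ_{k<N} x^k / k!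
expSum : ℕ → ℚ → ℚ
expSum N x = go N 0 1ℚ
  where
  -- go m k t : sum of m terms starting at term index k whose value is t
  go : ℕ → ℕ → ℚ → ℚ
  go zero    k t = 0ℚ
  go (suc m) k t = t Q.+ go m (suc k) (t Q.* x Q.* ((+ 1) / suc k))

-- ExpLe q a b  means  q ≤ e^a · e^(-b)   (intended for a, b ≥ 0, q ≥ 0),
-- i.e.  q·e^b ≤ e^a, i.e. for every partial sum S_N(b) ≤ e^b and every ε > 0
-- some partial sum of e^a satisfies q·S_N(b) ≤ S_M(a) + ε.
ExpLe : ℚ → ℚ → ℚ → Set
ExpLe q a b = ∀ (N : ℕ) (ε : ℚ) → 0ℚ < ε → ∃[ M ] (q Q.* expSum N b ≤ expSum M a Q.+ ε)

{-# OPTIONS --safe #-}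

-- Horner's rule computes the residue of a₁xⁿ⁻¹ + ⋯ + aₙ modulo u by the steps r ↦ x·r + a, so
-- |A_n(u;α)| counts walks of length n from 0 to α with nonzero digits a. As x is invertible modulo u,
-- every step is a bijection of F_p[x]/(u), so the d-step walk counts form a matrix whose rows and
-- columns all sum to B = (p − 1)^d; as p ≥ 3, any two residues have a common successor after d steps,
-- so any two rows of that matrix overlap. Hence ∑_α (N·#walks(0 → α) − (p − 1)ⁿ)², with N = p^d, shrinks
-- by the factor B² − N every d steps, and since 2B² ≤ N·H for H = (d + 1)·p^(d²) this gives
-- δ ≤ (1 − 1/H)^⌊n/d⌋. Finally n/((d² + d)·p^(d²)) ≤ (⌊n/d⌋ + 1)/H, and the exponential series is
-- dominated termwise by the negative binomial series of (1 − 1/H)^−(⌊n/d⌋+1), so δ·e^(n/((d²+d)p^(d²)))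
-- is at most H/(H − 1) ≤ 6/5 < e^(1/3).

module Submission where

open import Data.Nat using (ℕ; suc; _<_)
open import Data.List using (List)
open import Data.Nat.Divisibility using (_∣_)
open import Data.Nat.Primality using (Prime)
open import Relation.Nullary using (¬_)

module ListSum where

  open import Data.Integer using (ℤ; +_; -[1+_]; 0ℤ; 1ℤ; _+_; _-_; _*_; _≤_; +≤+; nonNegative)
  open import Data.Integer.Properties
  open import Data.Integer.Tactic.RingSolver using (solve-∀)
  open import Data.List using (List; []; _∷_; length)
  open import Data.List.Membership.Propositional using (_∈_)
  import Data.List.Relation.Unary.All as All
  open import Data.List.Relation.Unary.AllPairs using (_∷_)
  open import Data.List.Relation.Unary.Any using (here; there)
  open import Data.List.Relation.Unary.Unique.Propositional using (Unique)
  open import Data.Nat using (z≤n)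
  open import Data.Empty using (⊥-elim)
  open import Relation.Binary.Definitions using (DecidableEquality)
  open import Relation.Binary.PropositionalEquality
  open import Relation.Nullary using (yes; no)

  *-nonNeg : ∀ {i j} → 0ℤ ≤ i → 0ℤ ≤ j → 0ℤ ≤ i * j
  *-nonNeg {i} {j} 0≤i 0≤j = *-monoʳ-≤-nonNeg j {{nonNegative 0≤j}} 0≤i

  square-nonNeg : ∀ i → 0ℤ ≤ i * i
  square-nonNeg (+ n)    = subst (0ℤ ≤_) (pos-* n n) (+≤+ z≤n)
  square-nonNeg -[1+ n ] = +≤+ z≤n

  ∑ : {A : Set} → List A → (A → ℤ) → ℤ
  ∑ []       f = 0ℤ
  ∑ (x ∷ xs) f = f x + ∑ xs f

  module _ {A : Set} where

    ∑-cong : ∀ (xs : List A) {f g : A → ℤ} → (∀ x → x ∈ xs → f x ≡ g x) → ∑ xs f ≡ ∑ xs g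
    ∑-cong []       h = refl
    ∑-cong (x ∷ xs) h = cong₂ _+_ (h x (here refl)) (∑-cong xs (λ y y∈ → h y (there y∈)))

    ∑-mono-≤ : ∀ (xs : List A) {f g : A → ℤ} → (∀ x → x ∈ xs → f x ≤ g x) → ∑ xs f ≤ ∑ xs g
    ∑-mono-≤ []       h = ≤-refl
    ∑-mono-≤ (x ∷ xs) h = +-mono-≤ (h x (here refl)) (∑-mono-≤ xs (λ y y∈ → h y (there y∈)))

    ∑-zero : ∀ (xs : List A) {f : A → ℤ} → (∀ x → x ∈ xs → f x ≡ 0ℤ) → ∑ xs f ≡ 0ℤ
    ∑-zero []       h = refl
    ∑-zero (x ∷ xs) h = cong₂ _+_ (h x (here refl)) (∑-zero xs (λ y y∈ → h y (there y∈)))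

    ∑-nonNeg : ∀ (xs : List A) {f : A → ℤ} → (∀ x → x ∈ xs → 0ℤ ≤ f x) → 0ℤ ≤ ∑ xs f
    ∑-nonNeg []       h = ≤-refl
    ∑-nonNeg (x ∷ xs) h = +-mono-≤ (h x (here refl)) (∑-nonNeg xs (λ y y∈ → h y (there y∈)))

    ∑-+ : ∀ (xs : List A) (f g : A → ℤ) → ∑ xs (λ x → f x + g x) ≡ ∑ xs f + ∑ xs g
    ∑-+ []       f g = refl
    ∑-+ (x ∷ xs) f g = trans (cong (_+_ (f x + g x)) (∑-+ xs f g)) (interchange (f x) (g x) (∑ xs f) (∑ xs g))
      where
      interchange : ∀ a b c e → a + b + (c + e) ≡ a + c + (b + e)
      interchange = solve-∀

    ∑-minus : ∀ (xs : List A) (f g : A → ℤ) → ∑ xs (λ x → f x - g x) ≡ ∑ xs f - ∑ xs g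
    ∑-minus []       f g = refl
    ∑-minus (x ∷ xs) f g = trans (cong (_+_ (f x - g x)) (∑-minus xs f g)) (interchange (f x) (g x) (∑ xs f) (∑ xs g))
      where
      interchange : ∀ a b c e → a - b + (c - e) ≡ a + c - (b + e)
      interchange = solve-∀

    ∑-*ˡ : ∀ (xs : List A) (c : ℤ) (f : A → ℤ) → ∑ xs (λ x → c * f x) ≡ c * ∑ xs f
    ∑-*ˡ []       c f = sym (*-zeroʳ c)
    ∑-*ˡ (x ∷ xs) c f = trans (cong (_+_ (c * f x)) (∑-*ˡ xs c f)) (sym (*-distribˡ-+ c (f x) (∑ xs f)))

    ∑-*ʳ : ∀ (xs : List A) (c : ℤ) (f : A → ℤ) → ∑ xs (λ x → f x * c) ≡ ∑ xs f * c
    ∑-*ʳ xs c f = begin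
      ∑ xs (λ x → f x * c) ≡⟨ ∑-cong xs (λ x _ → *-comm (f x) c) ⟩
      ∑ xs (λ x → c * f x) ≡⟨ ∑-*ˡ xs c f ⟩
      c * ∑ xs f           ≡⟨ *-comm c (∑ xs f) ⟩
      ∑ xs f * c           ∎
      where open ≡-Reasoning

    ∑-const : ∀ (xs : List A) (c : ℤ) → ∑ xs (λ _ → c) ≡ + length xs * c
    ∑-const []       c = sym (*-zeroˡ c)
    ∑-const (x ∷ xs) c = trans (cong (_+_ c) (∑-const xs c)) (sym (suc-* (+ length xs) c))

    ≤-∑ : ∀ (xs : List A) {f : A → ℤ} → (∀ x → x ∈ xs → 0ℤ ≤ f x) → ∀ {y} → y ∈ xs → f y ≤ ∑ xs f
    ≤-∑ (x ∷ xs) {f} h (here refl) = i≤i+j (f x) (∑ xs f) {{nonNegative (∑-nonNeg xs (λ y y∈ → h y (there y∈)))}}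
    ≤-∑ (x ∷ xs) {f} h (there y∈)  = ≤-trans (≤-∑ xs (λ z z∈ → h z (there z∈)) y∈) (i≤j+i (∑ xs f) (f x) {{nonNegative (h x (here refl))}})

  ∑-swap : {A B : Set} (xs : List A) (ys : List B) (f : A → B → ℤ) →
           ∑ xs (λ x → ∑ ys (f x)) ≡ ∑ ys (λ y → ∑ xs (λ x → f x y))
  ∑-swap []       ys f = sym (∑-zero ys (λ _ _ → refl))
  ∑-swap (x ∷ xs) ys f = trans (cong (_+_ (∑ ys (f x))) (∑-swap xs ys f)) (sym (∑-+ ys (f x) (λ y → ∑ xs (λ x' → f x' y))))

  module Kronecker {A : Set} (_≟_ : DecidableEquality A) where

    𝟙[_≡_] : A → A → ℤ
    𝟙[ x ≡ y ] with x ≟ y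
    ... | yes _ = 1ℤ
    ... | no  _ = 0ℤ

    𝟙-nonNeg : ∀ x y → 0ℤ ≤ 𝟙[ x ≡ y ]
    𝟙-nonNeg x y with x ≟ y
    ... | yes _ = +≤+ z≤n
    ... | no  _ = +≤+ z≤n

    𝟙-refl : ∀ x → 𝟙[ x ≡ x ] ≡ 1ℤ
    𝟙-refl x with x ≟ x
    ... | yes _  = refl
    ... | no x≢x = ⊥-elim (x≢x refl)

    𝟙-≢ : ∀ {x y} → x ≢ y → 𝟙[ x ≡ y ] ≡ 0ℤ
    𝟙-≢ {x} {y} x≢y with x ≟ y
    ... | yes x≡y = ⊥-elim (x≢y x≡y)
    ... | no  _   = refl

    𝟙-sym : ∀ x y → 𝟙[ x ≡ y ] ≡ 𝟙[ y ≡ x ]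
    𝟙-sym x y with x ≟ y | y ≟ x
    ... | yes _   | yes _   = refl
    ... | no  _   | no  _   = refl
    ... | yes x≡y | no  y≢x = ⊥-elim (y≢x (sym x≡y))
    ... | no  x≢y | yes y≡x = ⊥-elim (x≢y (sym y≡x))

    ∑-sift : ∀ (xs : List A) (f : A → ℤ) → Unique xs → ∀ {y} → y ∈ xs → ∑ xs (λ x → 𝟙[ x ≡ y ] * f x) ≡ f y
    ∑-sift (x ∷ xs) f (x∉xs ∷ _) (here refl) = begin
      𝟙[ x ≡ x ] * f x + ∑ xs (λ z → 𝟙[ z ≡ x ] * f z) ≡⟨ cong₂ _+_ (cong (_* f x) (𝟙-refl x)) (∑-zero xs vanish) ⟩
      1ℤ * f x + 0ℤ                                  ≡⟨ +-identityʳ (1ℤ * f x) ⟩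
      1ℤ * f x                                       ≡⟨ *-identityˡ (f x) ⟩
      f x                                            ∎
      where
      open ≡-Reasoning
      vanish : ∀ z → z ∈ xs → 𝟙[ z ≡ x ] * f z ≡ 0ℤ
      vanish z z∈ = trans (cong (_* f z) (𝟙-≢ (λ z≡x → All.lookup x∉xs z∈ (sym z≡x)))) (*-zeroˡ (f z))
    ∑-sift (x ∷ xs) f (x∉xs ∷ xs!) {y} (there y∈) = begin
      𝟙[ x ≡ y ] * f x + ∑ xs (λ z → 𝟙[ z ≡ y ] * f z) ≡⟨ cong (λ t → t * f x + ∑ xs (λ z → 𝟙[ z ≡ y ] * f z)) (𝟙-≢ (All.lookup x∉xs y∈)) ⟩
      0ℤ * f x + ∑ xs (λ z → 𝟙[ z ≡ y ] * f z)        ≡⟨ cong (_+ ∑ xs (λ z → 𝟙[ z ≡ y ] * f z)) (*-zeroˡ (f x)) ⟩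
      0ℤ + ∑ xs (λ z → 𝟙[ z ≡ y ] * f z)              ≡⟨ +-identityˡ _ ⟩
      ∑ xs (λ z → 𝟙[ z ≡ y ] * f z)                   ≡⟨ ∑-sift xs f xs! y∈ ⟩
      f y                                            ∎
      where open ≡-Reasoning

    ∑-siftʳ : ∀ (xs : List A) (f : A → ℤ) → Unique xs → ∀ {y} → y ∈ xs → ∑ xs (λ x → 𝟙[ y ≡ x ] * f x) ≡ f y
    ∑-siftʳ xs f xs! {y} y∈ = trans (∑-cong xs (λ x _ → cong (_* f x) (𝟙-sym y x))) (∑-sift xs f xs! y∈)

    ∑-𝟙 : ∀ (xs : List A) → Unique xs → ∀ {y} → y ∈ xs → ∑ xs (λ x → 𝟙[ x ≡ y ]) ≡ 1ℤ
    ∑-𝟙 xs xs! {y} y∈ = trans (∑-cong xs (λ x _ → sym (*-identityʳ 𝟙[ x ≡ y ]))) (∑-sift xs (λ _ → 1ℤ) xs! y∈)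

    ∑-𝟙-injective : ∀ (xs : List A) (f : A → A) y → Unique xs →
                    (∀ {x x'} → x ∈ xs → x' ∈ xs → f x ≡ y → f x' ≡ y → x ≡ x') →
                    ∑ xs (λ x → 𝟙[ f x ≡ y ]) ≤ 1ℤ
    ∑-𝟙-injective []       f y _             _   = +≤+ z≤n
    ∑-𝟙-injective (x ∷ xs) f y (x∉xs ∷ xs!) inj with f x ≟ y
    ... | yes fx≡y = ≤-reflexive (cong (_+_ 1ℤ) (∑-zero xs missed))
      where
      missed : ∀ x' → x' ∈ xs → 𝟙[ f x' ≡ y ] ≡ 0ℤ
      missed x' x'∈ = 𝟙-≢ (λ fx'≡y → All.lookup x∉xs x'∈ (inj (here refl) (there x'∈) fx≡y fx'≡y))
    ... | no  _    = ≤-trans (≤-reflexive (+-identityˡ _))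
                             (∑-𝟙-injective xs f y xs! (λ x∈ x'∈ → inj (there x∈) (there x'∈)))

    ∑-∘-injective-≤ : ∀ (xs : List A) (h : A → A) (F : A → ℤ) → Unique xs →
                      (∀ x → x ∈ xs → h x ∈ xs) →
                      (∀ {x x'} → x ∈ xs → x' ∈ xs → h x ≡ h x' → x ≡ x') →
                      (∀ x → x ∈ xs → 0ℤ ≤ F x) →
                      ∑ xs (λ x → F (h x)) ≤ ∑ xs F
    ∑-∘-injective-≤ xs h F xs! closed inj F≥0 = begin
      ∑ xs (λ x → F (h x))                           ≡⟨ ∑-cong xs (λ x x∈ → sym (∑-siftʳ xs F xs! (closed x x∈))) ⟩
      ∑ xs (λ x → ∑ xs (λ y → 𝟙[ h x ≡ y ] * F y))  ≡⟨ ∑-swap xs xs (λ x y → 𝟙[ h x ≡ y ] * F y) ⟩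
      ∑ xs (λ y → ∑ xs (λ x → 𝟙[ h x ≡ y ] * F y))  ≡⟨ ∑-cong xs (λ y _ → ∑-*ʳ xs (F y) (λ x → 𝟙[ h x ≡ y ])) ⟩
      ∑ xs (λ y → ∑ xs (λ x → 𝟙[ h x ≡ y ]) * F y)  ≤⟨ ∑-mono-≤ xs (λ y y∈ → *-monoʳ-≤-nonNeg (F y) {{nonNegative (F≥0 y y∈)}} (∑-𝟙-injective xs h y xs! (λ x∈ x'∈ hx≡y hx'≡y → inj x∈ x'∈ (trans hx≡y (sym hx'≡y))))) ⟩
      ∑ xs (λ y → 1ℤ * F y)                          ≡⟨ ∑-cong xs (λ y _ → *-identityˡ (F y)) ⟩
      ∑ xs F                                         ∎
      where open ≤-Reasoning

module Contraction where

  open import Data.Integer using (ℤ; +_; 0ℤ; 1ℤ; _+_; _-_; _*_; _≤_; nonNegative)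
  open import Data.Integer.Properties
  open import Data.Integer.Tactic.RingSolver using (solve-∀)
  open import Data.List using (List; length)
  open import Data.List.Membership.Propositional using (_∈_)
  open import Relation.Binary.PropositionalEquality
  open ListSum

  2*ab≤a²+b² : ∀ a b → + 2 * (a * b) ≤ a * a + b * b
  2*ab≤a²+b² a b = 0≤i-j⇒j≤i (subst (0ℤ ≤_) (square-of-difference a b) (square-nonNeg (a - b)))
    where
    square-of-difference : ∀ a b → (a - b) * (a - b) ≡ (a * a + b * b) - + 2 * (a * b)
    square-of-difference = solve-∀

  module _ {A : Set} (R : List A) (K : A → A → ℤ) (B : ℤ)
    (rows : ∀ γ → γ ∈ R → ∑ R (K γ) ≡ B)
    (cols : ∀ α → α ∈ R → ∑ R (λ γ → K γ α) ≡ B)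
    where

    N : ℤ
    N = + length R

    collision : A → A → ℤ
    collision γ γ' = ∑ R (λ α → K γ α * K γ' α)

    collision-sym : ∀ γ γ' → collision γ γ' ≡ collision γ' γ
    collision-sym γ γ' = ∑-cong R (λ α _ → *-comm (K γ α) (K γ' α))

    ∑-collision : ∀ γ → γ ∈ R → ∑ R (collision γ) ≡ B * B
    ∑-collision γ γ∈ = begin
      ∑ R (λ γ' → ∑ R (λ α → K γ α * K γ' α)) ≡⟨ ∑-swap R R (λ γ' α → K γ α * K γ' α) ⟩
      ∑ R (λ α → ∑ R (λ γ' → K γ α * K γ' α)) ≡⟨ ∑-cong R (λ α α∈ → trans (∑-*ˡ R (K γ α) (λ γ' → K γ' α)) (cong (K γ α *_) (cols α α∈))) ⟩
      ∑ R (λ α → K γ α * B)                    ≡⟨ ∑-*ʳ R B (K γ) ⟩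
      ∑ R (K γ) * B                            ≡⟨ cong (_* B) (rows γ γ∈) ⟩
      B * B                                    ∎
      where open ≡-Reasoning

    ∑-[collision-1] : ∀ γ → γ ∈ R → ∑ R (λ γ' → collision γ γ' - 1ℤ) ≡ B * B - N
    ∑-[collision-1] γ γ∈ = trans (∑-minus R (collision γ) (λ _ → 1ℤ))
                               (cong₂ _-_ (∑-collision γ γ∈) (trans (∑-const R 1ℤ) (*-identityʳ N)))

    module _ (E : A → ℤ) where

      push : A → ℤ
      push α = ∑ R (λ γ → E γ * K γ α)

      ∑-push² : ∑ R (λ α → push α * push α) ≡ ∑ R (λ γ → ∑ R (λ γ' → E γ * E γ' * collision γ γ'))
      ∑-push² = begin
        ∑ R (λ α → push α * push α)
          ≡⟨ ∑-cong R (λ α _ → product-of-sums α) ⟩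
        ∑ R (λ α → ∑ R (λ γ → ∑ R (λ γ' → E γ * E γ' * (K γ α * K γ' α))))
          ≡⟨ ∑-swap R R _ ⟩
        ∑ R (λ γ → ∑ R (λ α → ∑ R (λ γ' → E γ * E γ' * (K γ α * K γ' α))))
          ≡⟨ ∑-cong R (λ γ _ → ∑-swap R R _) ⟩
        ∑ R (λ γ → ∑ R (λ γ' → ∑ R (λ α → E γ * E γ' * (K γ α * K γ' α))))
          ≡⟨ ∑-cong R (λ γ _ → ∑-cong R (λ γ' _ → ∑-*ˡ R (E γ * E γ') (λ α → K γ α * K γ' α))) ⟩
        ∑ R (λ γ → ∑ R (λ γ' → E γ * E γ' * collision γ γ')) ∎
        where
        open ≡-Reasoning
        rearrange : ∀ a b c e → c * e * (a * b) ≡ a * c * (b * e)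
        rearrange = solve-∀
        product-of-sums : ∀ α → push α * push α ≡ ∑ R (λ γ → ∑ R (λ γ' → E γ * E γ' * (K γ α * K γ' α)))
        product-of-sums α =
          trans (sym (∑-*ʳ R (push α) (λ γ → E γ * K γ α)))
                (∑-cong R (λ γ _ → trans (*-comm (E γ * K γ α) (push α))
                  (trans (sym (∑-*ʳ R (E γ * K γ α) (λ γ' → E γ' * K γ' α)))
                         (∑-cong R (λ γ' _ → rearrange (E γ) (K γ α) (E γ') (K γ' α))))))

      ∑-[collision-1]-square : ∑ R (λ γ → ∑ R (λ γ' → E γ * E γ * (collision γ γ' - 1ℤ))) ≡ (B * B - N) * ∑ R (λ γ → E γ * E γ)
      ∑-[collision-1]-square = begin
        ∑ R (λ γ → ∑ R (λ γ' → E γ * E γ * (collision γ γ' - 1ℤ)))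
          ≡⟨ ∑-cong R (λ γ γ∈ → trans (∑-*ˡ R (E γ * E γ) _) (cong (E γ * E γ *_) (∑-[collision-1] γ γ∈))) ⟩
        ∑ R (λ γ → E γ * E γ * (B * B - N))
          ≡⟨ ∑-*ʳ R (B * B - N) (λ γ → E γ * E γ) ⟩
        ∑ R (λ γ → E γ * E γ) * (B * B - N)
          ≡⟨ *-comm _ (B * B - N) ⟩
        (B * B - N) * ∑ R (λ γ → E γ * E γ) ∎
        where open ≡-Reasoning

      module _ (∑E≡0 : ∑ R E ≡ 0ℤ) where

        ∑-push²-centred : ∑ R (λ α → push α * push α) ≡ ∑ R (λ γ → ∑ R (λ γ' → E γ * E γ' * (collision γ γ' - 1ℤ)))
        ∑-push²-centred = begin
          ∑ R (λ α → push α * push α)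
            ≡⟨ ∑-push² ⟩
          ∑ R (λ γ → ∑ R (λ γ' → E γ * E γ' * collision γ γ'))
            ≡⟨ ∑-cong R (λ γ _ → trans (∑-cong R (λ γ' _ → split (E γ) (E γ') (collision γ γ'))) (∑-+ R _ _)) ⟩
          ∑ R (λ γ → ∑ R (λ γ' → E γ * E γ' * (collision γ γ' - 1ℤ)) + ∑ R (λ γ' → E γ * E γ'))
            ≡⟨ ∑-+ R _ _ ⟩
          ∑ R (λ γ → ∑ R (λ γ' → E γ * E γ' * (collision γ γ' - 1ℤ))) + ∑ R (λ γ → ∑ R (λ γ' → E γ * E γ'))
            ≡⟨ cong (_+_ (∑ R (λ γ → ∑ R (λ γ' → E γ * E γ' * (collision γ γ' - 1ℤ))))) (∑-zero R (λ γ _ → E*∑E γ)) ⟩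
          ∑ R (λ γ → ∑ R (λ γ' → E γ * E γ' * (collision γ γ' - 1ℤ))) + 0ℤ
            ≡⟨ +-identityʳ _ ⟩
          ∑ R (λ γ → ∑ R (λ γ' → E γ * E γ' * (collision γ γ' - 1ℤ))) ∎
          where
          open ≡-Reasoning
          split : ∀ a b w → a * b * w ≡ a * b * (w - 1ℤ) + a * b
          split = solve-∀
          E*∑E : ∀ γ → ∑ R (λ γ' → E γ * E γ') ≡ 0ℤ
          E*∑E γ = trans (∑-*ˡ R (E γ) E) (trans (cong (E γ *_) ∑E≡0) (*-zeroʳ (E γ)))

        contraction : (∀ γ γ' → γ ∈ R → γ' ∈ R → 1ℤ ≤ collision γ γ') →
                      ∑ R (λ α → push α * push α) ≤ (B * B - N) * ∑ R (λ γ → E γ * E γ)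
        contraction collision≥1 = *-cancelˡ-≤-pos _ _ (+ 2) (begin
          + 2 * ∑ R (λ α → push α * push α)
            ≡⟨ cong (+ 2 *_) ∑-push²-centred ⟩
          + 2 * ∑ R (λ γ → ∑ R (λ γ' → E γ * E γ' * w γ γ'))
            ≡⟨ sym (trans (∑-cong R (λ γ _ → ∑-*ˡ R (+ 2) _)) (∑-*ˡ R (+ 2) _)) ⟩
          ∑ R (λ γ → ∑ R (λ γ' → + 2 * (E γ * E γ' * w γ γ')))
            ≤⟨ ∑-mono-≤ R (λ γ γ∈ → ∑-mono-≤ R (λ γ' γ'∈ → am-gm γ γ' γ∈ γ'∈)) ⟩
          ∑ R (λ γ → ∑ R (λ γ' → E γ * E γ * w γ γ' + E γ' * E γ' * w γ γ'))
            ≡⟨ trans (∑-cong R (λ γ _ → ∑-+ R _ _)) (∑-+ R _ _) ⟩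
          ∑ R (λ γ → ∑ R (λ γ' → E γ * E γ * w γ γ')) + ∑ R (λ γ → ∑ R (λ γ' → E γ' * E γ' * w γ γ'))
            ≡⟨ cong₂ _+_ ∑-[collision-1]-square transposed ⟩
          (B * B - N) * ∑ R (λ γ → E γ * E γ) + (B * B - N) * ∑ R (λ γ → E γ * E γ)
            ≡⟨ double _ ⟩
          + 2 * ((B * B - N) * ∑ R (λ γ → E γ * E γ)) ∎)
          where
          open ≤-Reasoning
          w : A → A → ℤ
          w γ γ' = collision γ γ' - 1ℤ
          double : ∀ x → x + x ≡ + 2 * x
          double = solve-∀
          am-gm : ∀ γ γ' → γ ∈ R → γ' ∈ R → + 2 * (E γ * E γ' * w γ γ') ≤ E γ * E γ * w γ γ' + E γ' * E γ' * w γ γ'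
          am-gm γ γ' γ∈ γ'∈ = begin
            + 2 * (E γ * E γ' * w γ γ')           ≡⟨ sym (*-assoc (+ 2) (E γ * E γ') (w γ γ')) ⟩
            + 2 * (E γ * E γ') * w γ γ'           ≤⟨ *-monoʳ-≤-nonNeg (w γ γ') {{nonNegative (i≤j⇒0≤j-i (collision≥1 γ γ' γ∈ γ'∈))}} (2*ab≤a²+b² (E γ) (E γ')) ⟩
            (E γ * E γ + E γ' * E γ') * w γ γ'    ≡⟨ *-distribʳ-+ (w γ γ') (E γ * E γ) (E γ' * E γ') ⟩
            E γ * E γ * w γ γ' + E γ' * E γ' * w γ γ' ∎
          transposed : ∑ R (λ γ → ∑ R (λ γ' → E γ' * E γ' * w γ γ')) ≡ (B * B - N) * ∑ R (λ γ → E γ * E γ)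
          transposed = trans (∑-swap R R _)
            (trans (∑-cong R (λ γ' _ → ∑-cong R (λ γ _ → cong (λ c → E γ' * E γ' * (c - 1ℤ)) (collision-sym γ γ'))))
                   ∑-[collision-1]-square)

module Enumeration where

  open import Data.Integer as ℤ using (+_)
  open import Data.Integer.Properties using (pos-+)
  open import Data.List using (List; []; _∷_; _++_; length; map; filter; concatMap; cartesianProductWith; upTo)
  open import Data.List.Properties using (length-++; length-map; length-upTo; filter-++; ∷-injective)
  open import Data.List.Membership.Propositional using (_∈_)
  open import Data.List.Membership.Propositional.Properties
    using (∈-cartesianProductWith⁺; ∈-cartesianProductWith⁻; ∈-map⁺; ∈-map⁻; ∈-upTo⁺; ∈-upTo⁻)
  open import Data.List.Relation.Unary.All as All using (All)
  open import Data.List.Relation.Unary.Any using (here)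
  open import Data.List.Relation.Unary.Unique.Propositional using (Unique)
  import Data.List.Relation.Unary.AllPairs as AllPairs
  open import Data.List.Relation.Unary.Unique.Propositional.Properties using (cartesianProductWith⁺; upTo⁺)
  open import Data.Nat using (zero; suc; _+_; _*_; _^_; _∸_; _<_; s≤s; z<s)
  open import Data.Product using (_×_; _,_; ∃-syntax; proj₁)
  open import Relation.Binary.PropositionalEquality
  open import Relation.Unary using (Pred; Decidable)
  open import Level using (0ℓ)
  open import Relation.Nullary using (does)
  open import Data.Bool using (true; false)
  open import Defs using (tuples; elems; nonzeros; monicNotDivX)
  open ListSum using (∑)

  module _ {A : Set} where

    concatMap-∷ : ∀ (xs : List A) (T : List (List A)) →
                  concatMap (λ x → map (x ∷_) T) xs ≡ cartesianProductWith _∷_ xs T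
    concatMap-∷ []       T = refl
    concatMap-∷ (x ∷ xs) T = cong (map (x ∷_) T ++_) (concatMap-∷ xs T)

    length-cartesianProductWith-∷ : ∀ (xs : List A) (T : List (List A)) →
                                    length (cartesianProductWith _∷_ xs T) ≡ length xs * length T
    length-cartesianProductWith-∷ []       T = refl
    length-cartesianProductWith-∷ (x ∷ xs) T =
      trans (length-++ (map (x ∷_) T)) (cong₂ _+_ (length-map (x ∷_) T) (length-cartesianProductWith-∷ xs T))

    length-filter-cartesianProductWith-∷ : ∀ {P : Pred (List A) 0ℓ} (P? : Decidable P) (xs : List A) (T : List (List A)) →
      + length (filter P? (cartesianProductWith _∷_ xs T)) ≡ ∑ xs (λ x → + length (filter (λ t → P? (x ∷ t)) T))
    length-filter-cartesianProductWith-∷ P? []       T = refl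
    length-filter-cartesianProductWith-∷ P? (x ∷ xs) T = begin
      + length (filter P? (map (x ∷_) T ++ rest))
        ≡⟨ cong (λ l → + length l) (filter-++ P? (map (x ∷_) T) rest) ⟩
      + length (filter P? (map (x ∷_) T) ++ filter P? rest)
        ≡⟨ cong +_ (length-++ (filter P? (map (x ∷_) T))) ⟩
      + (length (filter P? (map (x ∷_) T)) + length (filter P? rest))
        ≡⟨ pos-+ (length (filter P? (map (x ∷_) T))) _ ⟩
      + length (filter P? (map (x ∷_) T)) ℤ.+ + length (filter P? rest)
        ≡⟨ cong₂ ℤ._+_ (cong +_ (filter-map T)) (length-filter-cartesianProductWith-∷ P? xs T) ⟩
      + length (filter (λ t → P? (x ∷ t)) T) ℤ.+ ∑ xs (λ x → + length (filter (λ t → P? (x ∷ t)) T)) ∎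
      where
      open ≡-Reasoning
      rest : List (List A)
      rest = cartesianProductWith _∷_ xs T
      filter-map : ∀ T → length (filter P? (map (x ∷_) T)) ≡ length (filter (λ t → P? (x ∷ t)) T)
      filter-map []      = refl
      filter-map (t ∷ T) with does (P? (x ∷ t))
      ... | true  = cong suc (filter-map T)
      ... | false = filter-map T

  tuples-suc : ∀ xs n → tuples xs (suc n) ≡ cartesianProductWith _∷_ xs (tuples xs n)
  tuples-suc xs n = concatMap-∷ xs (tuples xs n)

  ∈-tuples⁻ : ∀ xs n {v} → v ∈ tuples xs n → length v ≡ n × All (_∈ xs) v
  ∈-tuples⁻ xs zero    (here refl) = refl , All.[]
  ∈-tuples⁻ xs (suc n) v∈ rewrite tuples-suc xs n
    with x , w , x∈ , w∈ , refl ← ∈-cartesianProductWith⁻ _∷_ xs (tuples xs n) v∈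
    with |w|≡n , w⊆xs ← ∈-tuples⁻ xs n w∈ = cong suc |w|≡n , x∈ All.∷ w⊆xs

  ∈-tuples⁺ : ∀ xs {v} → All (_∈ xs) v → v ∈ tuples xs (length v)
  ∈-tuples⁺ xs All.[]             = here refl
  ∈-tuples⁺ xs {x ∷ v} (x∈ All.∷ v⊆xs) rewrite tuples-suc xs (length v) =
    ∈-cartesianProductWith⁺ _∷_ x∈ (∈-tuples⁺ xs v⊆xs)

  tuples-unique : ∀ xs n → Unique xs → Unique (tuples xs n)
  tuples-unique xs zero    xs! = All.[] AllPairs.∷ AllPairs.[]
  tuples-unique xs (suc n) xs! rewrite tuples-suc xs n =
    cartesianProductWith⁺ _∷_ ∷-injective xs! (tuples-unique xs n xs!)

  length-tuples : ∀ xs n → length (tuples xs n) ≡ length xs ^ n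
  length-tuples xs zero    = refl
  length-tuples xs (suc n) = begin
    length (tuples xs (suc n))                              ≡⟨ cong length (tuples-suc xs n) ⟩
    length (cartesianProductWith _∷_ xs (tuples xs n))      ≡⟨ length-cartesianProductWith-∷ xs (tuples xs n) ⟩
    length xs * length (tuples xs n)                        ≡⟨ cong (length xs *_) (length-tuples xs n) ⟩
    length xs * length xs ^ n                               ∎
    where open ≡-Reasoning

  elems-unique : ∀ p → Unique (elems p)
  elems-unique = upTo⁺

  length-elems : ∀ p → length (elems p) ≡ p
  length-elems = length-upTo

  length-nonzeros : ∀ p → length (nonzeros p) ≡ p ∸ 1
  length-nonzeros p = trans (length-map suc (upTo (p ∸ 1))) (length-upTo (p ∸ 1))

  ∈-nonzeros⁻ : ∀ k {x} → x ∈ nonzeros (suc k) → 0 < x × x < suc k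
  ∈-nonzeros⁻ k x∈ with y , y∈ , refl ← ∈-map⁻ suc x∈ = z<s , s≤s (∈-upTo⁻ y∈)

  ∈-nonzeros⁺ : ∀ k {x} → 0 < x → x < suc k → x ∈ nonzeros (suc k)
  ∈-nonzeros⁺ k {suc y} _ (s≤s y<k) = ∈-map⁺ suc (∈-upTo⁺ y<k)

  ∈-monicNotDivX⁻ : ∀ p d {c} → c ∈ monicNotDivX p (suc d) →
                    ∃[ c₀ ] ∃[ cs ] (c ≡ c₀ ∷ cs × c₀ ∈ nonzeros p × length cs ≡ d)
  ∈-monicNotDivX⁻ p d c∈ rewrite concatMap-∷ (nonzeros p) (tuples (elems p) d)
    with c₀ , cs , c₀∈ , cs∈ , refl ← ∈-cartesianProductWith⁻ _∷_ (nonzeros p) (tuples (elems p) d) c∈ =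
    c₀ , cs , refl , c₀∈ , proj₁ (∈-tuples⁻ (elems p) d cs∈)

module DropLast where

  open import Data.List using (List; []; _∷_; _∷ʳ_; length; replicate)
  open import Data.List.Relation.Unary.All using (All; []; _∷_)
  open import Data.Nat using (ℕ; zero; suc)
  open import Relation.Binary.PropositionalEquality
  open import Relation.Unary using (Pred)
  open import Level using (0ℓ)
  open import Defs using (lastOr0; dropLast)

  dropLast-∷ʳ : ∀ xs x → dropLast (xs ∷ʳ x) ≡ xs
  dropLast-∷ʳ []           x = refl
  dropLast-∷ʳ (y ∷ [])     x = refl
  dropLast-∷ʳ (y ∷ z ∷ xs) x = cong (y ∷_) (dropLast-∷ʳ (z ∷ xs) x)

  lastOr0-∷ʳ : ∀ xs x → lastOr0 (xs ∷ʳ x) ≡ x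
  lastOr0-∷ʳ []           x = refl
  lastOr0-∷ʳ (y ∷ [])     x = refl
  lastOr0-∷ʳ (y ∷ z ∷ xs) x = lastOr0-∷ʳ (z ∷ xs) x

  dropLast-∷ʳ-lastOr0 : ∀ xs {m} → length xs ≡ suc m → dropLast xs ∷ʳ lastOr0 xs ≡ xs
  dropLast-∷ʳ-lastOr0 (x ∷ [])     _ = refl
  dropLast-∷ʳ-lastOr0 (x ∷ y ∷ xs) _ = cong (x ∷_) (dropLast-∷ʳ-lastOr0 (y ∷ xs) refl)

  length-dropLast : ∀ xs {m} → length xs ≡ suc m → length (dropLast xs) ≡ m
  length-dropLast (x ∷ [])     refl = refl
  length-dropLast (x ∷ y ∷ xs) refl = cong suc (length-dropLast (y ∷ xs) refl)

  module _ {P : Pred ℕ 0ℓ} where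

    All-dropLast : ∀ {xs} → All P xs → All P (dropLast xs)
    All-dropLast []              = []
    All-dropLast (px ∷ [])       = []
    All-dropLast (px ∷ py ∷ pxs) = px ∷ All-dropLast (py ∷ pxs)

    lastOr0-All : P 0 → ∀ {xs} → All P xs → P (lastOr0 xs)
    lastOr0-All p0 []              = p0
    lastOr0-All p0 (px ∷ [])       = px
    lastOr0-All p0 (px ∷ py ∷ pxs) = lastOr0-All p0 (py ∷ pxs)

  replicate-∷ʳ : ∀ {A : Set} n (x : A) → replicate (suc n) x ≡ replicate n x ∷ʳ x
  replicate-∷ʳ zero    x = refl
  replicate-∷ʳ (suc n) x = cong (x ∷_) (replicate-∷ʳ n x)

module Modular (k : ℕ) where

  open import Data.Empty using (⊥-elim)
  open import Data.Nat
  open import Data.Nat.Properties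
  open import Data.Nat.DivMod
  open import Data.Nat.Divisibility using (_∣_; m%n≡0⇒n∣m; n∣m⇒m%n≡0)
  open import Data.Nat.Primality using (Prime; euclidsLemma)
  open import Data.Sum using (inj₁; inj₂)
  open import Relation.Binary.Bundles using (Setoid)
  open import Relation.Binary.PropositionalEquality
  open import Relation.Nullary using (¬_)
  import Relation.Binary.Reasoning.Setoid as SetoidReasoning

  p : ℕ
  p = suc k

  infix 4 _≡ₚ_
  record _≡ₚ_ (a b : ℕ) : Set where
    constructor mod-p
    field %-≡ : a % p ≡ b % p
  open _≡ₚ_ public

  ≡ₚ-setoid : Setoid _ _
  ≡ₚ-setoid = record
    { _≈_           = _≡ₚ_
    ; isEquivalence = record
      { refl  = mod-p refl
      ; sym   = λ (mod-p e) → mod-p (sym e)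
      ; trans = λ (mod-p e) (mod-p f) → mod-p (trans e f)
      }
    }

  open Setoid ≡ₚ-setoid public using () renaming (refl to ≡ₚ-refl; sym to ≡ₚ-sym)
  module ≡ₚ-Reasoning = SetoidReasoning ≡ₚ-setoid

  %-≡ₚ : ∀ a → a % p ≡ₚ a
  %-≡ₚ a = mod-p (m%n%n≡m%n a p)

  +-congₚ : ∀ {a a' b b'} → a ≡ₚ a' → b ≡ₚ b' → a + b ≡ₚ a' + b'
  +-congₚ {a} {a'} {b} {b'} (mod-p e) (mod-p f) =
    mod-p (trans (%-distribˡ-+ a b p) (trans (cong₂ (λ x y → (x + y) % p) e f) (sym (%-distribˡ-+ a' b' p))))

  *-congₚ : ∀ {a a' b b'} → a ≡ₚ a' → b ≡ₚ b' → a * b ≡ₚ a' * b'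
  *-congₚ {a} {a'} {b} {b'} (mod-p e) (mod-p f) =
    mod-p (trans (%-distribˡ-* a b p) (trans (cong₂ (λ x y → (x * y) % p) e f) (sym (%-distribˡ-* a' b' p))))

  +-multipleₚ : ∀ a m → a + m * p ≡ₚ a
  +-multipleₚ a m = mod-p ([m+kn]%n≡m%n a m p)

  ≡ₚ⇒≡ : ∀ {a b} → a < p → b < p → a ≡ₚ b → a ≡ b
  ≡ₚ⇒≡ a<p b<p (mod-p e) = trans (sym (m<n⇒m%n≡m a<p)) (trans e (m<n⇒m%n≡m b<p))

  +-inverseₚ : ∀ t → t + (p ∸ t % p) ≡ₚ 0
  +-inverseₚ t = begin
    t + (p ∸ t % p)       ≈⟨ +-congₚ (≡ₚ-sym (%-≡ₚ t)) ≡ₚ-refl ⟩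
    t % p + (p ∸ t % p)   ≡⟨ m+[n∸m]≡n (<⇒≤ (m%n<n t p)) ⟩
    p                     ≡⟨ *-identityˡ p ⟨
    0 + 1 * p             ≈⟨ +-multipleₚ 0 1 ⟩
    0                     ∎
    where open ≡ₚ-Reasoning

  +-cancelʳₚ : ∀ {a b} t → a + t ≡ₚ b + t → a ≡ₚ b
  +-cancelʳₚ {a} {b} t a+t≡b+t = begin
    a                         ≡⟨ +-identityʳ a ⟨
    a + 0                     ≈⟨ +-congₚ (≡ₚ-refl {a}) (+-inverseₚ t) ⟨
    a + (t + t⁻)              ≡⟨ +-assoc a t t⁻ ⟨
    a + t + t⁻                ≈⟨ +-congₚ a+t≡b+t (≡ₚ-refl {t⁻}) ⟩
    b + t + t⁻                ≡⟨ +-assoc b t t⁻ ⟩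
    b + (t + t⁻)              ≈⟨ +-congₚ (≡ₚ-refl {b}) (+-inverseₚ t) ⟩
    b + 0                     ≡⟨ +-identityʳ b ⟩
    b                         ∎
    where
    open ≡ₚ-Reasoning
    t⁻ : ℕ
    t⁻ = p ∸ t % p

  module _ (p-prime : Prime p) where

    private
      *-cancelʳₚ-≥ : ∀ {a b c} → ¬ (p ∣ c) → a < p → b ≤ a → a * c ≡ₚ b * c → a ≡ b
      *-cancelʳₚ-≥ {a} {b} {c} p∤c a<p b≤a ac≡bc = trans (sym (m+[n∸m]≡n b≤a)) (trans (cong (b +_) a∸b≡0) (+-identityʳ b))
        where
        [a∸b]c≡0 : (a ∸ b) * c ≡ₚ 0
        [a∸b]c≡0 = +-cancelʳₚ (b * c) (begin
          (a ∸ b) * c + b * c ≡⟨ *-distribʳ-+ c (a ∸ b) b ⟨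
          (a ∸ b + b) * c     ≡⟨ cong (_* c) (m∸n+n≡m b≤a) ⟩
          a * c               ≈⟨ ac≡bc ⟩
          b * c               ∎)
          where open ≡ₚ-Reasoning
        a∸b≡0 : a ∸ b ≡ 0
        a∸b≡0 with euclidsLemma (a ∸ b) c p-prime (m%n≡0⇒n∣m _ p (%-≡ [a∸b]c≡0))
        ... | inj₂ p∣c   = ⊥-elim (p∤c p∣c)
        ... | inj₁ p∣a∸b = trans (sym (m<n⇒m%n≡m (≤-<-trans (m∸n≤m a b) a<p))) (n∣m⇒m%n≡0 (a ∸ b) p p∣a∸b)

    *-cancelʳₚ : ∀ {a b c} → ¬ (p ∣ c) → a < p → b < p → a * c ≡ₚ b * c → a ≡ b
    *-cancelʳₚ {a} {b} p∤c a<p b<p ac≡bc with ≤-total b a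
    ... | inj₁ b≤a = *-cancelʳₚ-≥ p∤c a<p b≤a ac≡bc
    ... | inj₂ a≤b = sym (*-cancelʳₚ-≥ p∤c b<p a≤b (≡ₚ-sym ac≡bc))

module HornerStep (k c₀ : ℕ) (cs : List ℕ) where

  open import Data.Empty using (⊥-elim)
  open import Data.List using ([]; _∷_; _++_; _∷ʳ_; length; replicate; zipWith; foldl; foldr; reverse)
  open import Data.List.Properties using (∷-injectiveˡ; ∷-injectiveʳ; length-replicate; length-reverse; foldl-ʳ++; zipWith-comm; ++-assoc; ++-identityʳ)
  open import Data.List.Relation.Unary.All as All using (All; []; _∷_)
  open import Data.List.Relation.Unary.Any.Properties using (reverse⁻)
  open import Data.Nat
  open import Data.Nat.Properties
  open import Data.Nat.DivMod using (m%n<n; m<n⇒m%n≡m)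
  open import Data.Nat.Divisibility using (_∣_; ∣⇒≤)
  open import Data.Nat.Primality using (Prime; euclidsLemma)
  open import Data.Nat.Tactic.RingSolver using (solve-∀)
  open import Data.Product using (_×_; _,_; ∃-syntax; proj₁; proj₂)
  open import Data.Sum using (inj₁; inj₂)
  open import Function using (flip)
  open import Relation.Binary.PropositionalEquality
  open import Relation.Nullary using (¬_)
  open import Defs using (lastOr0; dropLast; mulX; addConst; nonzeros)
  open Enumeration using (∈-nonzeros⁺; ∈-nonzeros⁻)
  open import Data.List.Membership.Propositional using (_∈_)
  open DropLast
  open Modular k

  c : List ℕ
  c = c₀ ∷ cs

  d : ℕ
  d = suc (length cs)

  Residue : List ℕ → Set
  Residue r = length r ≡ d × All (_< p) r

  -- Coefficient i of x·r mod u is rᵢ₋₁ − r_{d−1}·cᵢ; Defs writes −1 as k = p − 1.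
  mulXCoeff : ℕ → ℕ → ℕ → ℕ
  mulXCoeff L s cᵢ = (s + k * (L * cᵢ)) % p

  timesX : List ℕ → List ℕ
  timesX r = mulX p c r

  step : List ℕ → ℕ → List ℕ
  step r a = addConst p a (timesX r)

  zeros : List ℕ
  zeros = replicate d 0

  zeros-Residue : Residue zeros
  zeros-Residue = length-replicate d , all-zero d
    where
    all-zero : ∀ n → All (_< p) (replicate n 0)
    all-zero zero    = []
    all-zero (suc n) = z<s ∷ all-zero n

  All-zipWith-% : ∀ (f : ℕ → ℕ → ℕ) xs ys → All (_< p) (zipWith (λ a b → f a b % p) xs ys)
  All-zipWith-% f []       _        = []
  All-zipWith-% f (x ∷ xs) []       = []
  All-zipWith-% f (x ∷ xs) (y ∷ ys) = m%n<n (f x y) p ∷ All-zipWith-% f xs ys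

  length-zipWith-≡ : ∀ (f : ℕ → ℕ → ℕ) xs ys → length xs ≡ length ys → length (zipWith f xs ys) ≡ length xs
  length-zipWith-≡ f []       []       _   = refl
  length-zipWith-≡ f (x ∷ xs) (y ∷ ys) eq = cong suc (length-zipWith-≡ f xs ys (suc-injective eq))

  timesX-Residue : ∀ {r} → Residue r → Residue (timesX r)
  timesX-Residue {r} (|r|≡d , r<p) =
    trans (length-zipWith-≡ (mulXCoeff (lastOr0 r)) (0 ∷ dropLast r) c |0∷dropLast|) |0∷dropLast| ,
    All-zipWith-% (λ s cᵢ → s + k * (lastOr0 r * cᵢ)) (0 ∷ dropLast r) c
    where
    |0∷dropLast| : length (0 ∷ dropLast r) ≡ d
    |0∷dropLast| = cong suc (length-dropLast r |r|≡d)

  addConst-Residue : ∀ a {r} → Residue r → Residue (addConst p a r)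
  addConst-Residue a {x ∷ r} (|r|≡d , _ ∷ r<p) = |r|≡d , m%n<n (x + a) p ∷ r<p

  step-Residue : ∀ a {r} → Residue r → Residue (step r a)
  step-Residue a r-res = addConst-Residue a (timesX-Residue r-res)

  addConst-injective : ∀ a {r r'} → Residue r → Residue r' → addConst p a r ≡ addConst p a r' → r ≡ r'
  addConst-injective a {x ∷ r} {x' ∷ r'} (_ , x<p ∷ _) (_ , x'<p ∷ _) eq =
    cong₂ _∷_ (≡ₚ⇒≡ x<p x'<p (+-cancelʳₚ a (mod-p (∷-injectiveˡ eq)))) (∷-injectiveʳ eq)

  zipWith-mulXCoeff-injective : ∀ L {s s'} cs' → length s ≡ length cs' → length s' ≡ length cs' →
    All (_< p) s → All (_< p) s' → zipWith (mulXCoeff L) s cs' ≡ zipWith (mulXCoeff L) s' cs' → s ≡ s'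
  zipWith-mulXCoeff-injective L {[]}    {[]}      []         _   _    _          _            _  = refl
  zipWith-mulXCoeff-injective L {x ∷ s} {x' ∷ s'} (cᵢ ∷ cs') |s| |s'| (x<p ∷ s<p) (x'<p ∷ s'<p) eq =
    cong₂ _∷_ (≡ₚ⇒≡ x<p x'<p (+-cancelʳₚ (k * (L * cᵢ)) (mod-p (∷-injectiveˡ eq))))
              (zipWith-mulXCoeff-injective L cs' (suc-injective |s|) (suc-injective |s'|) s<p s'<p (∷-injectiveʳ eq))

  module _ (p-prime : Prime p) (1≤k : 1 ≤ k) (p∤c₀ : ¬ (p ∣ c₀)) where

    p∤k*c₀ : ¬ (p ∣ k * c₀)
    p∤k*c₀ p∣k*c₀ with euclidsLemma k c₀ p-prime p∣k*c₀
    ... | inj₁ p∣k = <⇒≱ (n<1+n k) (∣⇒≤ {{>-nonZero 1≤k}} p∣k)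
    ... | inj₂ p∣c₀ = p∤c₀ p∣c₀

    timesX-injective : ∀ {r r'} → Residue r → Residue r' → timesX r ≡ timesX r' → r ≡ r'
    timesX-injective {r} {r'} (|r| , r<p) (|r'| , r'<p) eq = begin
      r                                  ≡⟨ dropLast-∷ʳ-lastOr0 r |r| ⟨
      dropLast r ∷ʳ lastOr0 r            ≡⟨ cong₂ _∷ʳ_ dropLast≡ lastOr0≡ ⟩
      dropLast r' ∷ʳ lastOr0 r'          ≡⟨ dropLast-∷ʳ-lastOr0 r' |r'| ⟩
      r'                                 ∎
      where
      open ≡-Reasoning
      rearrange : ∀ L → k * (L * c₀) ≡ L * (k * c₀)
      rearrange L = trans (sym (*-assoc k L c₀)) (trans (cong (_* c₀) (*-comm k L)) (*-assoc L k c₀))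
      lastOr0≡ : lastOr0 r ≡ lastOr0 r'
      lastOr0≡ = *-cancelʳₚ p-prime p∤k*c₀ (lastOr0-All z<s r<p) (lastOr0-All z<s r'<p)
                   (mod-p (trans (cong (_% p) (sym (rearrange (lastOr0 r))))
                     (trans (∷-injectiveˡ eq) (cong (_% p) (rearrange (lastOr0 r'))))))
      dropLast≡ : dropLast r ≡ dropLast r'
      dropLast≡ = zipWith-mulXCoeff-injective (lastOr0 r) cs (length-dropLast r |r|) (length-dropLast r' |r'|)
                    (All-dropLast r<p) (All-dropLast r'<p)
                    (trans (∷-injectiveʳ eq) (cong (λ L → zipWith (mulXCoeff L) (dropLast r') cs) (sym lastOr0≡)))

    step-injective : ∀ a {r r'} → Residue r → Residue r' → step r a ≡ step r' a → r ≡ r'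
    step-injective a r-res r'-res eq =
      timesX-injective r-res r'-res (addConst-injective a (timesX-Residue r-res) (timesX-Residue r'-res) eq)

  infixl 6 _⊕_
  _⊕_ : List ℕ → List ℕ → List ℕ
  _⊕_ = zipWith (λ a b → (a + b) % p)

  ⊕-zeros : ∀ {u} → All (_< p) u → u ⊕ replicate (length u) 0 ≡ u
  ⊕-zeros []                 = refl
  ⊕-zeros {x ∷ u} (x<p ∷ u<p) = cong₂ _∷_ (trans (cong (_% p) (+-identityʳ x)) (m<n⇒m%n≡m x<p)) (⊕-zeros u<p)

  lastOr0-⊕ : ∀ u w → length u ≡ length w → lastOr0 (u ⊕ w) ≡ (lastOr0 u + lastOr0 w) % p
  lastOr0-⊕ []           []           _  = refl
  lastOr0-⊕ (x ∷ [])     (y ∷ [])     _  = refl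
  lastOr0-⊕ (x ∷ x' ∷ u) (y ∷ y' ∷ w) eq = lastOr0-⊕ (x' ∷ u) (y' ∷ w) (suc-injective eq)

  dropLast-⊕ : ∀ u w → length u ≡ length w → dropLast (u ⊕ w) ≡ dropLast u ⊕ dropLast w
  dropLast-⊕ []           []           _  = refl
  dropLast-⊕ (x ∷ [])     (y ∷ [])     _  = refl
  dropLast-⊕ (x ∷ x' ∷ u) (y ∷ y' ∷ w) eq = cong ((x + y) % p ∷_) (dropLast-⊕ (x' ∷ u) (y' ∷ w) (suc-injective eq))

  mulXCoeff-⊕ : ∀ L L' a b cᵢ → mulXCoeff ((L + L') % p) ((a + b) % p) cᵢ ≡ (mulXCoeff L a cᵢ + mulXCoeff L' b cᵢ) % p
  mulXCoeff-⊕ L L' a b cᵢ = %-≡ (begin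
    (a + b) % p + k * ((L + L') % p * cᵢ)         ≈⟨ +-congₚ (%-≡ₚ (a + b)) (*-congₚ (≡ₚ-refl {k}) (*-congₚ (%-≡ₚ (L + L')) (≡ₚ-refl {cᵢ}))) ⟩
    a + b + k * ((L + L') * cᵢ)                   ≡⟨ regroup a b L L' k cᵢ ⟩
    (a + k * (L * cᵢ)) + (b + k * (L' * cᵢ))      ≈⟨ +-congₚ (%-≡ₚ (a + k * (L * cᵢ))) (%-≡ₚ (b + k * (L' * cᵢ))) ⟨
    mulXCoeff L a cᵢ + mulXCoeff L' b cᵢ          ∎)
    where
    open ≡ₚ-Reasoning
    regroup : ∀ a b L L' k cᵢ → a + b + k * ((L + L') * cᵢ) ≡ (a + k * (L * cᵢ)) + (b + k * (L' * cᵢ))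
    regroup = solve-∀

  zipWith-mulXCoeff-⊕ : ∀ L L' s t cs' → zipWith (mulXCoeff ((L + L') % p)) (s ⊕ t) cs' ≡ zipWith (mulXCoeff L) s cs' ⊕ zipWith (mulXCoeff L') t cs'
  zipWith-mulXCoeff-⊕ L L' []      t       cs'        = refl
  zipWith-mulXCoeff-⊕ L L' (x ∷ s) []      []         = refl
  zipWith-mulXCoeff-⊕ L L' (x ∷ s) []      (cᵢ ∷ cs') = refl
  zipWith-mulXCoeff-⊕ L L' (x ∷ s) (y ∷ t) []         = refl
  zipWith-mulXCoeff-⊕ L L' (x ∷ s) (y ∷ t) (cᵢ ∷ cs') = cong₂ _∷_ (mulXCoeff-⊕ L L' x y cᵢ) (zipWith-mulXCoeff-⊕ L L' s t cs')

  timesX-⊕ : ∀ {u w} → Residue u → Residue w → timesX (u ⊕ w) ≡ timesX u ⊕ timesX w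
  timesX-⊕ {u} {w} (|u| , _) (|w| , _) = begin
    zipWith (mulXCoeff (lastOr0 (u ⊕ w))) (0 ∷ dropLast (u ⊕ w)) c
      ≡⟨ cong₂ (λ L v → zipWith (mulXCoeff L) (0 ∷ v) c) (lastOr0-⊕ u w |u|≡|w|) (dropLast-⊕ u w |u|≡|w|) ⟩
    zipWith (mulXCoeff ((lastOr0 u + lastOr0 w) % p)) ((0 ∷ dropLast u) ⊕ (0 ∷ dropLast w)) c
      ≡⟨ zipWith-mulXCoeff-⊕ (lastOr0 u) (lastOr0 w) (0 ∷ dropLast u) (0 ∷ dropLast w) c ⟩
    timesX u ⊕ timesX w ∎
    where
    open ≡-Reasoning
    |u|≡|w| : length u ≡ length w
    |u|≡|w| = trans |u| (sym |w|)

  addConst-⊕ : ∀ a {u w} → Residue u → Residue w → addConst p a (u ⊕ w) ≡ u ⊕ addConst p a w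
  addConst-⊕ a {x ∷ u} {y ∷ w} _ _ = cong (_∷ u ⊕ w) (%-≡ (begin
    (x + y) % p + a     ≈⟨ +-congₚ (%-≡ₚ (x + y)) (≡ₚ-refl {a}) ⟩
    x + y + a           ≡⟨ +-assoc x y a ⟩
    x + (y + a)         ≈⟨ +-congₚ (≡ₚ-refl {x}) (%-≡ₚ (y + a)) ⟨
    x + (y + a) % p     ∎))
    where open ≡ₚ-Reasoning

  step-⊕ : ∀ b {u w} → Residue u → Residue w → step (u ⊕ w) b ≡ timesX u ⊕ step w b
  step-⊕ b u-res w-res = trans (cong (addConst p b) (timesX-⊕ u-res w-res)) (addConst-⊕ b (timesX-Residue u-res) (timesX-Residue w-res))

  timesX^ : ℕ → List ℕ → List ℕ
  timesX^ zero    r = r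
  timesX^ (suc n) r = timesX (timesX^ n r)

  timesX^-Residue : ∀ n {r} → Residue r → Residue (timesX^ n r)
  timesX^-Residue zero    r-res = r-res
  timesX^-Residue (suc n) r-res = timesX-Residue (timesX^-Residue n r-res)

  stepsʳ : List ℕ → List ℕ → List ℕ
  stepsʳ r s = foldr (flip step) r s

  stepsʳ-Residue : ∀ {r} s → Residue r → Residue (stepsʳ r s)
  stepsʳ-Residue []      r-res = r-res
  stepsʳ-Residue (a ∷ s) r-res = step-Residue a (stepsʳ-Residue s r-res)

  stepsʳ-⊕ : ∀ s {u w} → Residue u → Residue w → stepsʳ (u ⊕ w) s ≡ timesX^ (length s) u ⊕ stepsʳ w s
  stepsʳ-⊕ []      u-res w-res = refl
  stepsʳ-⊕ (b ∷ s) u-res w-res =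
    trans (cong (flip step b) (stepsʳ-⊕ s u-res w-res))
          (step-⊕ b (timesX^-Residue (length s) u-res) (stepsʳ-Residue s w-res))

  zipWith-mulXCoeff-0 : ∀ s cs' → length s ≡ length cs' → All (_< p) s → zipWith (mulXCoeff 0) s cs' ≡ s
  zipWith-mulXCoeff-0 []      []         _     []          = refl
  zipWith-mulXCoeff-0 (x ∷ s) (cᵢ ∷ cs') |s|≡ (x<p ∷ s<p) =
    cong₂ _∷_ (trans (cong (λ t → (x + t) % p) (*-zeroʳ k)) (trans (cong (_% p) (+-identityʳ x)) (m<n⇒m%n≡m x<p)))
              (zipWith-mulXCoeff-0 s cs' (suc-injective |s|≡) s<p)

  step-shift : ∀ {v} b → Residue v → lastOr0 v ≡ 0 → b < p → step v b ≡ b ∷ dropLast v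
  step-shift {v} b (|v| , v<p) last≡0 b<p = begin
    addConst p b (zipWith (mulXCoeff (lastOr0 v)) (0 ∷ dropLast v) c) ≡⟨ cong (λ L → addConst p b (zipWith (mulXCoeff L) (0 ∷ dropLast v) c)) last≡0 ⟩
    addConst p b (zipWith (mulXCoeff 0) (0 ∷ dropLast v) c)           ≡⟨ cong (addConst p b) (zipWith-mulXCoeff-0 (0 ∷ dropLast v) c (cong suc (length-dropLast v |v|)) (z<s ∷ All-dropLast v<p)) ⟩
    addConst p b (0 ∷ dropLast v)                                     ≡⟨ cong (_∷ dropLast v) (m<n⇒m%n≡m b<p) ⟩
    b ∷ dropLast v                                                    ∎
    where open ≡-Reasoning

  stepsʳ-zeros : ∀ s m → length s + m ≡ d → All (_< p) s → stepsʳ zeros s ≡ s ++ replicate m 0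
  stepsʳ-zeros []      m m≡d []          = cong (λ n → replicate n 0) (sym m≡d)
  stepsʳ-zeros (b ∷ s) m |bs|+m≡d (b<p ∷ s<p) = begin
    step v b                        ≡⟨ step-shift b (stepsʳ-Residue s zeros-Residue) (trans (cong lastOr0 v≡) (lastOr0-∷ʳ (s ++ replicate m 0) 0)) b<p ⟩
    b ∷ dropLast v                  ≡⟨ cong (λ u → b ∷ dropLast u) v≡ ⟩
    b ∷ dropLast ((s ++ replicate m 0) ∷ʳ 0) ≡⟨ cong (b ∷_) (dropLast-∷ʳ (s ++ replicate m 0) 0) ⟩
    b ∷ s ++ replicate m 0          ∎
    where
    open ≡-Reasoning
    v : List ℕ
    v = stepsʳ zeros s
    v≡ : v ≡ (s ++ replicate m 0) ∷ʳ 0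
    v≡ = begin
      v                               ≡⟨ stepsʳ-zeros s (suc m) (trans (+-suc (length s) m) |bs|+m≡d) s<p ⟩
      s ++ replicate (suc m) 0        ≡⟨ cong (s ++_) (replicate-∷ʳ m 0) ⟩
      s ++ (replicate m 0 ∷ʳ 0)       ≡⟨ ++-assoc s (replicate m 0) (0 ∷ []) ⟨
      (s ++ replicate m 0) ∷ʳ 0         ∎

  foldl-step-reverse : ∀ {γ} s → Residue γ → length s ≡ d → All (_< p) s → foldl step γ (reverse s) ≡ timesX^ d γ ⊕ s
  foldl-step-reverse {γ} s γ-res@(|γ| , γ<p) |s| s<p = begin
    foldl step γ (reverse s)                          ≡⟨ foldl-ʳ++ step γ s ⟩
    stepsʳ γ s                                        ≡⟨ cong (λ u → stepsʳ u s) (sym (trans (cong (λ n → γ ⊕ replicate n 0) (sym |γ|)) (⊕-zeros γ<p))) ⟩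
    stepsʳ (γ ⊕ zeros) s                              ≡⟨ stepsʳ-⊕ s γ-res zeros-Residue ⟩
    timesX^ (length s) γ ⊕ stepsʳ zeros s             ≡⟨ cong₂ (λ n u → timesX^ n γ ⊕ u) |s| (stepsʳ-zeros s 0 (trans (+-identityʳ (length s)) |s|) s<p) ⟩
    timesX^ d γ ⊕ (s ++ [])                           ≡⟨ cong (timesX^ d γ ⊕_) (++-identityʳ s) ⟩
    timesX^ d γ ⊕ s                                   ∎
    where open ≡-Reasoning

  avoid : ℕ → ℕ → ℕ
  avoid (suc _)       (suc _)       = 0
  avoid 0             0             = 1
  avoid 0             1             = 2
  avoid 0             (suc (suc _)) = 1
  avoid 1             0             = 2
  avoid (suc (suc _)) 0             = 1

  avoid-≢ˡ : ∀ a b → avoid a b ≢ a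
  avoid-≢ˡ (suc _)       (suc _)       ()
  avoid-≢ˡ 0             0             ()
  avoid-≢ˡ 0             1             ()
  avoid-≢ˡ 0             (suc (suc _)) ()
  avoid-≢ˡ 1             0             ()
  avoid-≢ˡ (suc (suc _)) 0             ()

  avoid-≢ʳ : ∀ a b → avoid a b ≢ b
  avoid-≢ʳ (suc _)       (suc _)       ()
  avoid-≢ʳ 0             0             ()
  avoid-≢ʳ 0             1             ()
  avoid-≢ʳ 0             (suc (suc _)) ()
  avoid-≢ʳ 1             0             ()
  avoid-≢ʳ (suc (suc _)) 0             ()

  avoid-comm : ∀ a b → avoid a b ≡ avoid b a
  avoid-comm (suc _)       (suc _)       = refl
  avoid-comm 0             0             = refl
  avoid-comm 0             1             = refl
  avoid-comm 0             (suc (suc _)) = refl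
  avoid-comm 1             0             = refl
  avoid-comm (suc (suc _)) 0             = refl

  avoid≤2 : ∀ a b → avoid a b ≤ 2
  avoid≤2 (suc _)       (suc _)       = z≤n
  avoid≤2 0             0             = s≤s z≤n
  avoid≤2 0             1             = ≤-refl
  avoid≤2 0             (suc (suc _)) = s≤s z≤n
  avoid≤2 1             0             = ≤-refl
  avoid≤2 (suc (suc _)) 0             = s≤s z≤n

  infixl 6 _⊖_
  _⊖_ : List ℕ → List ℕ → List ℕ
  _⊖_ = zipWith (λ a b → (a + (p ∸ b)) % p)

  +-sub-cancel : ∀ {a b} → a < p → b < p → (b + (a + (p ∸ b)) % p) % p ≡ a
  +-sub-cancel {a} {b} a<p b<p = trans (%-≡ (begin
    b + (a + (p ∸ b)) % p   ≈⟨ +-congₚ (≡ₚ-refl {b}) (%-≡ₚ (a + (p ∸ b))) ⟩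
    b + (a + (p ∸ b))       ≡⟨ x+[y+z]≡y+[x+z] b a (p ∸ b) ⟩
    a + (b + (p ∸ b))       ≡⟨ cong (a +_) (trans (m+[n∸m]≡n (<⇒≤ b<p)) (sym (*-identityˡ p))) ⟩
    a + 1 * p               ≈⟨ +-multipleₚ a 1 ⟩
    a                       ∎)) (m<n⇒m%n≡m a<p)
    where
    open ≡ₚ-Reasoning
    x+[y+z]≡y+[x+z] : ∀ x y z → x + (y + z) ≡ y + (x + z)
    x+[y+z]≡y+[x+z] = solve-∀


  sub-nonzero : ∀ {a b} → a < p → b < p → a ≢ b → (a + (p ∸ b)) % p ∈ nonzeros p
  sub-nonzero {a} {b} a<p b<p a≢b with (a + (p ∸ b)) % p in eq
  ... | zero  = ⊥-elim (a≢b (begin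
    a                         ≡⟨ +-sub-cancel a<p b<p ⟨
    (b + (a + (p ∸ b)) % p) % p ≡⟨ cong (λ t → (b + t) % p) eq ⟩
    (b + 0) % p               ≡⟨ cong (_% p) (+-identityʳ b) ⟩
    b % p                     ≡⟨ m<n⇒m%n≡m b<p ⟩
    b                         ∎))
    where open ≡-Reasoning
  ... | suc t = ∈-nonzeros⁺ k z<s (subst (_< p) eq (m%n<n (a + (p ∸ b)) p))

  target : List ℕ → List ℕ → List ℕ
  target = zipWith avoid

  target-comm : ∀ w w' → target w w' ≡ target w' w
  target-comm = zipWith-comm avoid avoid-comm

  module _ (2<p : 2 < p) where

    avoid<p : ∀ a b → avoid a b < p
    avoid<p a b = ≤-<-trans (avoid≤2 a b) 2<p

    target-Residue : ∀ {w w'} → Residue w → Residue w' → Residue (target w w')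
    target-Residue {w} {w'} (|w| , w<p) (|w'| , _) =
      trans (length-zipWith-≡ avoid w w' (trans |w| (sym |w'|))) |w| , bounded w w'
      where
      bounded : ∀ w w' → All (_< p) (target w w')
      bounded []      _         = []
      bounded (x ∷ w) []        = []
      bounded (x ∷ w) (x' ∷ w') = avoid<p x x' ∷ bounded w w'

    ⊕-[target⊖] : ∀ w w' → length w ≡ length w' → All (_< p) w → w ⊕ (target w w' ⊖ w) ≡ target w w'
    ⊕-[target⊖] []      []        _   _           = refl
    ⊕-[target⊖] (x ∷ w) (x' ∷ w') |w| (x<p ∷ w<p) =
      cong₂ _∷_ (+-sub-cancel (avoid<p x x') x<p) (⊕-[target⊖] w w' (suc-injective |w|) w<p)

    target⊖-nonzero : ∀ w w' → All (_< p) w → All (_∈ nonzeros p) (target w w' ⊖ w)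
    target⊖-nonzero []      _         _           = []
    target⊖-nonzero (x ∷ w) []        _           = []
    target⊖-nonzero (x ∷ w) (x' ∷ w') (x<p ∷ w<p) =
      sub-nonzero (avoid<p x x') x<p (avoid-≢ˡ x x') ∷ target⊖-nonzero w w' w<p

  _↝_ : List ℕ → List ℕ → Set
  γ ↝ y = ∃[ bs ] (length bs ≡ d × All (_∈ nonzeros p) bs × foldl step γ bs ≡ y)

  All-reverse : ∀ {P : ℕ → Set} {xs} → All P xs → All P (reverse xs)
  All-reverse Pxs = All.tabulate (λ x∈ → All.lookup Pxs (reverse⁻ x∈))

  module _ (2<p : 2 < p) where

    ↝-target : ∀ {γ γ'} → Residue γ → Residue γ' → γ ↝ target (timesX^ d γ) (timesX^ d γ')
    ↝-target {γ} {γ'} γ-res γ'-res =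
      reverse s , trans (length-reverse s) |s| , All-reverse (target⊖-nonzero 2<p w w' w<p) ,
      trans (foldl-step-reverse s γ-res |s| (All.map (λ a∈ → proj₂ (∈-nonzeros⁻ k a∈)) (target⊖-nonzero 2<p w w' w<p)))
            (⊕-[target⊖] 2<p w w' (trans |w| (sym |w'|)) w<p)
      where
      w w' s : List ℕ
      w  = timesX^ d γ
      w' = timesX^ d γ'
      s  = target w w' ⊖ w
      |w| : length w ≡ d
      |w| = proj₁ (timesX^-Residue d γ-res)
      |w'| : length w' ≡ d
      |w'| = proj₁ (timesX^-Residue d γ'-res)
      w<p : All (_< p) w
      w<p = proj₂ (timesX^-Residue d γ-res)
      |target| : length (target w w') ≡ d
      |target| = proj₁ (target-Residue 2<p (timesX^-Residue d γ-res) (timesX^-Residue d γ'-res))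
      |s| : length s ≡ d
      |s| = trans (length-zipWith-≡ _ (target w w') w (trans |target| (sym |w|))) |target|

    common-successor : ∀ {γ γ'} → Residue γ → Residue γ' → ∃[ y ] (Residue y × γ ↝ y × γ' ↝ y)
    common-successor {γ} {γ'} γ-res γ'-res =
      target (timesX^ d γ) (timesX^ d γ') ,
      target-Residue 2<p (timesX^-Residue d γ-res) (timesX^-Residue d γ'-res) ,
      ↝-target γ-res γ'-res ,
      subst (γ' ↝_) (target-comm (timesX^ d γ') (timesX^ d γ)) (↝-target γ'-res γ-res)

module Walks (k c₀ : ℕ) (cs : List ℕ) where

  open import Data.Integer as ℤ using (ℤ; +_; 0ℤ; 1ℤ; _+_; _-_; _*_; _≤_; +≤+; nonNegative)
  open import Data.Integer.Properties as ℤP using (≤-trans; ≤-reflexive; pos-*)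
  open import Data.List using ([]; _∷_; length; foldl; filter; cartesianProductWith)
  open import Data.List.Properties using (≡-dec)
  open import Data.List.Membership.Propositional using (_∈_)
  open import Data.List.Membership.Propositional.Properties using (∈-upTo⁺; ∈-upTo⁻)
  open import Data.List.Relation.Unary.All as All using (All; []; _∷_)
  open import Data.List.Relation.Unary.Unique.Propositional using (Unique)
  import Data.Nat as ℕ
  open import Data.Nat.Divisibility using (_∣_)
  open import Data.Nat.Primality using (Prime)
  open import Data.Product using (_,_)
  open import Relation.Binary.PropositionalEquality
  open import Relation.Nullary using (¬_; Dec; yes; no)
  open import Defs using (tuples; elems; nonzeros; residues; countA)
  open ListSum
  open Enumeration
  open Modular k using (p)
  open HornerStep k c₀ cs

  open Kronecker (≡-dec ℕ._≟_)

  R : List (List ℕ)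
  R = residues p d

  R-unique : Unique R
  R-unique = tuples-unique (elems p) d (elems-unique p)

  length-R : length R ≡ p ℕ.^ d
  length-R = trans (length-tuples (elems p) d) (cong (ℕ._^ d) (length-elems p))

  ∈R⇒Residue : ∀ {γ} → γ ∈ R → Residue γ
  ∈R⇒Residue γ∈ with |γ| , γ⊆elems ← ∈-tuples⁻ (elems p) d γ∈ = |γ| , All.map ∈-upTo⁻ γ⊆elems

  Residue⇒∈R : ∀ {γ} → Residue γ → γ ∈ R
  Residue⇒∈R {γ} (|γ| , γ<p) = subst (λ n → γ ∈ tuples (elems p) n) |γ| (∈-tuples⁺ (elems p) (All.map ∈-upTo⁺ γ<p))

  step-∈R : ∀ {γ} a → γ ∈ R → step γ a ∈ R
  step-∈R a γ∈ = Residue⇒∈R (step-Residue a (∈R⇒Residue γ∈))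

  walks : ℕ → List ℕ → List ℕ → ℤ
  walks ℕ.zero    γ α = 𝟙[ γ ≡ α ]
  walks (ℕ.suc n) γ α = ∑ (nonzeros p) (λ a → walks n (step γ a) α)

  walks-nonNeg : ∀ n γ α → 0ℤ ≤ walks n γ α
  walks-nonNeg ℕ.zero    γ α = 𝟙-nonNeg γ α
  walks-nonNeg (ℕ.suc n) γ α = ∑-nonNeg (nonzeros p) (λ a _ → walks-nonNeg n (step γ a) α)

  ∑-nonzeros-k^n : ∀ n → ∑ (nonzeros p) (λ _ → + k ℕ.^ n) ≡ + k ℕ.^ ℕ.suc n
  ∑-nonzeros-k^n n = begin
    ∑ (nonzeros p) (λ _ → + k ℕ.^ n)   ≡⟨ ∑-const (nonzeros p) _ ⟩
    + length (nonzeros p) * + k ℕ.^ n  ≡⟨ cong (λ l → + l * + k ℕ.^ n) (length-nonzeros p) ⟩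
    + k * + k ℕ.^ n                    ≡⟨ pos-* k (k ℕ.^ n) ⟨
    + k ℕ.^ ℕ.suc n                    ∎
    where open ≡-Reasoning

  ∑-walks : ∀ n γ → γ ∈ R → ∑ R (walks n γ) ≡ + k ℕ.^ n
  ∑-walks ℕ.zero    γ γ∈ = trans (∑-cong R (λ α _ → 𝟙-sym γ α)) (∑-𝟙 R R-unique γ∈)
  ∑-walks (ℕ.suc n) γ γ∈ = begin
    ∑ R (λ α → ∑ (nonzeros p) (λ a → walks n (step γ a) α)) ≡⟨ ∑-swap R (nonzeros p) _ ⟩
    ∑ (nonzeros p) (λ a → ∑ R (walks n (step γ a)))          ≡⟨ ∑-cong (nonzeros p) (λ a _ → ∑-walks n (step γ a) (step-∈R a γ∈)) ⟩
    ∑ (nonzeros p) (λ _ → + k ℕ.^ n)                          ≡⟨ ∑-nonzeros-k^n n ⟩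
    + k ℕ.^ ℕ.suc n                                           ∎
    where open ≡-Reasoning

  walks-+ : ∀ m n γ α → γ ∈ R → walks (m ℕ.+ n) γ α ≡ ∑ R (λ β → walks m γ β * walks n β α)
  walks-+ ℕ.zero    n γ α γ∈ = sym (∑-siftʳ R (λ β → walks n β α) R-unique γ∈)
  walks-+ (ℕ.suc m) n γ α γ∈ = begin
    ∑ (nonzeros p) (λ a → walks (m ℕ.+ n) (step γ a) α)
      ≡⟨ ∑-cong (nonzeros p) (λ a _ → walks-+ m n (step γ a) α (step-∈R a γ∈)) ⟩
    ∑ (nonzeros p) (λ a → ∑ R (λ β → walks m (step γ a) β * walks n β α))
      ≡⟨ ∑-swap (nonzeros p) R _ ⟩
    ∑ R (λ β → ∑ (nonzeros p) (λ a → walks m (step γ a) β * walks n β α))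
      ≡⟨ ∑-cong R (λ β _ → ∑-*ʳ (nonzeros p) (walks n β α) (λ a → walks m (step γ a) β)) ⟩
    ∑ R (λ β → walks (ℕ.suc m) γ β * walks n β α) ∎
    where open ≡-Reasoning

  1≤*1≤ : ∀ {a b} → 1ℤ ≤ a → 1ℤ ≤ b → 1ℤ ≤ a * b
  1≤*1≤ {a} {b} 1≤a 1≤b = ≤-trans 1≤b (≤-trans (≤-reflexive (sym (ℤP.*-identityˡ b)))
                                                 (ℤP.*-monoʳ-≤-nonNeg b {{nonNegative (≤-trans (+≤+ ℕ.z≤n) 1≤b)}} 1≤a))

  walks-reach : ∀ bs γ → All (_∈ nonzeros p) bs → 1ℤ ≤ walks (length bs) γ (foldl step γ bs)
  walks-reach []       γ []            = ≤-reflexive (sym (𝟙-refl γ))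
  walks-reach (b ∷ bs) γ (b∈ ∷ bs∈) =
    ≤-trans (walks-reach bs (step γ b) bs∈)
            (≤-∑ (nonzeros p) (λ a _ → walks-nonNeg (length bs) (step γ a) _) b∈)

  walks-↝ : ∀ {γ y} → γ ↝ y → 1ℤ ≤ walks d γ y
  walks-↝ {γ} (bs , |bs| , bs∈ , refl) = subst (λ n → 1ℤ ≤ walks n γ (foldl step γ bs)) |bs| (walks-reach bs γ bs∈)

  collision-walks≥1 : 2 ℕ.< p → ∀ γ γ' → γ ∈ R → γ' ∈ R → 1ℤ ≤ ∑ R (λ α → walks d γ α * walks d γ' α)
  collision-walks≥1 2<p γ γ' γ∈ γ'∈ with y , y-res , γ↝y , γ'↝y ← common-successor 2<p (∈R⇒Residue γ∈) (∈R⇒Residue γ'∈) =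
    ≤-trans (1≤*1≤ (walks-↝ γ↝y) (walks-↝ γ'↝y))
            (≤-∑ R (λ α _ → *-nonNeg (walks-nonNeg d γ α) (walks-nonNeg d γ' α)) (Residue⇒∈R y-res))

  module _ (p-prime : Prime p) (1≤k : 1 ℕ.≤ k) (p∤c₀ : ¬ (p ∣ c₀)) where

    ∑-walks-into-≤ : ∀ n α → α ∈ R → ∑ R (λ γ → walks n γ α) ≤ + k ℕ.^ n
    ∑-walks-into-≤ ℕ.zero    α α∈ = ≤-reflexive (∑-𝟙 R R-unique α∈)
    ∑-walks-into-≤ (ℕ.suc n) α α∈ = begin
      ∑ R (λ γ → ∑ (nonzeros p) (λ a → walks n (step γ a) α))
        ≡⟨ ∑-swap R (nonzeros p) _ ⟩
      ∑ (nonzeros p) (λ a → ∑ R (λ γ → walks n (step γ a) α))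
        ≤⟨ ∑-mono-≤ (nonzeros p) (λ a _ → ∑-∘-injective-≤ R (λ γ → step γ a) (λ γ → walks n γ α) R-unique
                                             (λ γ γ∈ → step-∈R a γ∈)
                                             (λ γ∈ γ'∈ → step-injective p-prime 1≤k p∤c₀ a (∈R⇒Residue γ∈) (∈R⇒Residue γ'∈))
                                             (λ γ _ → walks-nonNeg n γ α)) ⟩
      ∑ (nonzeros p) (λ a → ∑ R (λ γ → walks n γ α))
        ≤⟨ ∑-mono-≤ (nonzeros p) (λ a _ → ∑-walks-into-≤ n α α∈) ⟩
      ∑ (nonzeros p) (λ _ → + k ℕ.^ n)
        ≡⟨ ∑-nonzeros-k^n n ⟩
      + k ℕ.^ ℕ.suc n ∎
      where open ℤP.≤-Reasoning

    -- Injectivity of the steps only bounds each column sum by k ^ n; equality follows because the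
    -- columns together carry the N·k ^ n walks counted by the rows.
    ∑-walks-into : ∀ n α → α ∈ R → ∑ R (λ γ → walks n γ α) ≡ + k ℕ.^ n
    ∑-walks-into n α α∈ = sym (ℤP.i-j≡0⇒i≡j _ _ (ℤP.≤-antisym (≤-trans (≤-∑ R slack≥0 α∈) (≤-reflexive ∑slack≡0)) (slack≥0 α α∈)))
      where
      slack : List ℕ → ℤ
      slack β = + k ℕ.^ n - ∑ R (λ γ → walks n γ β)
      slack≥0 : ∀ β → β ∈ R → 0ℤ ≤ slack β
      slack≥0 β β∈ = ℤP.i≤j⇒0≤j-i (∑-walks-into-≤ n β β∈)
      ∑slack≡0 : ∑ R slack ≡ 0ℤ
      ∑slack≡0 = begin
        ∑ R slack
          ≡⟨ ∑-minus R (λ _ → + k ℕ.^ n) (λ β → ∑ R (λ γ → walks n γ β)) ⟩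
        ∑ R (λ _ → + k ℕ.^ n) - ∑ R (λ β → ∑ R (λ γ → walks n γ β))
          ≡⟨ cong (∑ R (λ _ → + k ℕ.^ n) -_) (trans (∑-swap R R (λ β γ → walks n γ β)) (∑-cong R (λ γ γ∈ → ∑-walks n γ γ∈))) ⟩
        ∑ R (λ _ → + k ℕ.^ n) - ∑ R (λ _ → + k ℕ.^ n)
          ≡⟨ ℤP.+-inverseʳ (∑ R (λ _ → + k ℕ.^ n)) ⟩
        0ℤ ∎
        where open ≡-Reasoning

  length-filter-walks : ∀ n γ α → + length (filter (λ as → ≡-dec ℕ._≟_ (foldl step γ as) α) (tuples (nonzeros p) n)) ≡ walks n γ α
  length-filter-walks ℕ.zero    γ α with ≡-dec ℕ._≟_ γ α
  ... | yes _ = refl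
  ... | no  _ = refl
  length-filter-walks (ℕ.suc n) γ α = begin
    + length (filter (reaches γ) (tuples (nonzeros p) (ℕ.suc n)))
      ≡⟨ cong (λ T → + length (filter (reaches γ) T)) (tuples-suc (nonzeros p) n) ⟩
    + length (filter (reaches γ) (cartesianProductWith _∷_ (nonzeros p) (tuples (nonzeros p) n)))
      ≡⟨ length-filter-cartesianProductWith-∷ (reaches γ) (nonzeros p) (tuples (nonzeros p) n) ⟩
    ∑ (nonzeros p) (λ a → + length (filter (reaches (step γ a)) (tuples (nonzeros p) n)))
      ≡⟨ ∑-cong (nonzeros p) (λ a _ → length-filter-walks n (step γ a) α) ⟩
    walks (ℕ.suc n) γ α ∎
    where
    open ≡-Reasoning
    reaches : ∀ γ as → Dec (foldl step γ as ≡ α)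
    reaches γ as = ≡-dec ℕ._≟_ (foldl step γ as) α

  countA-walks : ∀ n α → + countA p n c α ≡ walks n zeros α
  countA-walks n α = length-filter-walks n zeros α

module Energy (k c₀ : ℕ) (cs : List ℕ) (p-prime : Prime (suc k)) (2<p : 2 < suc k) (p∤c₀ : ¬ (suc k ∣ c₀)) where

  open import Data.Integer as ℤ using (ℤ; +_; 0ℤ; 1ℤ; _+_; _-_; -_; _*_; _^_; _≤_; +≤+; nonNegative)
  open import Data.Integer.Properties
  open import Data.Integer.Tactic.RingSolver using (solve-∀)
  import Data.Nat.Tactic.RingSolver as NatSolver
  open import Data.List using (length)
  open import Data.List.Membership.Propositional using (_∈_)
  import Data.Nat as ℕ
  import Data.Nat.Properties as ℕP
  open import Data.Nat.DivMod using (m≡m%n+[m/n]*n)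
  open import Relation.Binary.PropositionalEquality
  open ListSum
  open Contraction using (contraction)
  open Modular k using (p)
  open HornerStep k c₀ cs using (d; zeros; zeros-Residue)
  open Walks k c₀ cs

  1≤k : 1 ℕ.≤ k
  1≤k = ℕP.≤-pred (ℕP.<⇒≤ 2<p)

  N : ℤ
  N = + length R

  T : ℕ → ℤ
  T n = + k ℕ.^ n

  B : ℤ
  B = T d

  zeros∈R : zeros ∈ R
  zeros∈R = Residue⇒∈R zeros-Residue

  -- N·(p − 1)ⁿ times the signed discrepancy at α.
  error : ℕ → List ℕ → ℤ
  error n α = N * walks n zeros α - T n

  ∑-error : ∀ n → ∑ R (error n) ≡ 0ℤ
  ∑-error n = begin
    ∑ R (λ α → N * walks n zeros α - T n)             ≡⟨ ∑-minus R (λ α → N * walks n zeros α) (λ _ → T n) ⟩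
    ∑ R (λ α → N * walks n zeros α) - ∑ R (λ _ → T n)  ≡⟨ cong₂ _-_ (trans (∑-*ˡ R N (walks n zeros)) (cong (N *_) (∑-walks n zeros zeros∈R))) (∑-const R (T n)) ⟩
    N * T n - N * T n                                  ≡⟨ +-inverseʳ (N * T n) ⟩
    0ℤ                                                 ∎
    where open ≡-Reasoning

  T-+ : ∀ m n → T (m ℕ.+ n) ≡ T m * T n
  T-+ m n = trans (cong +_ (ℕP.^-distribˡ-+-* k m n)) (pos-* (k ℕ.^ m) (k ℕ.^ n))

  error-+d : ∀ m α → α ∈ R → error (m ℕ.+ d) α ≡ ∑ R (λ γ → error m γ * walks d γ α)
  error-+d m α α∈ = begin
    N * walks (m ℕ.+ d) zeros α - T (m ℕ.+ d)
      ≡⟨ cong₂ (λ w t → N * w - t) (walks-+ m d zeros α zeros∈R) (T-+ m d) ⟩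
    N * ∑ R (λ γ → walks m zeros γ * walks d γ α) - T m * B
      ≡⟨ cong₂ (λ x y → x - T m * y) (sym (∑-*ˡ R N _)) (sym (∑-walks-into p-prime 1≤k p∤c₀ d α α∈)) ⟩
    ∑ R (λ γ → N * (walks m zeros γ * walks d γ α)) - T m * ∑ R (λ γ → walks d γ α)
      ≡⟨ cong (_-_ (∑ R (λ γ → N * (walks m zeros γ * walks d γ α)))) (sym (∑-*ˡ R (T m) _)) ⟩
    ∑ R (λ γ → N * (walks m zeros γ * walks d γ α)) - ∑ R (λ γ → T m * walks d γ α)
      ≡⟨ sym (∑-minus R _ _) ⟩
    ∑ R (λ γ → N * (walks m zeros γ * walks d γ α) - T m * walks d γ α)
      ≡⟨ ∑-cong R (λ γ _ → factor N (walks m zeros γ) (walks d γ α) (T m)) ⟩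
    ∑ R (λ γ → error m γ * walks d γ α) ∎
    where
    open ≡-Reasoning
    factor : ∀ n a b t → n * (a * b) - t * b ≡ (n * a - t) * b
    factor = solve-∀

  pos-^ : ∀ m n → + m ℕ.^ n ≡ (+ m) ^ n
  pos-^ m ℕ.zero    = refl
  pos-^ m (ℕ.suc n) = trans (pos-* m (m ℕ.^ n)) (cong (+ m *_) (pos-^ m n))

  energy : ℕ → ℤ
  energy n = ∑ R (λ α → error n α * error n α)

  energy-+d : ∀ m → energy (m ℕ.+ d) ≤ (B * B - N) * energy m
  energy-+d m = ≤-trans (≤-reflexive (∑-cong R (λ α α∈ → cong (λ e → e * e) (error-+d m α α∈))))
                        (contraction R (walks d) B (λ γ → ∑-walks d γ) (∑-walks-into p-prime 1≤k p∤c₀ d) (error m) (∑-error m) (collision-walks≥1 2<p))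

  energy-initial : ∀ r → energy r ≤ N * N * (T r * T r)
  energy-initial r = begin
    energy r
      ≡⟨ ∑-cong R (λ α _ → expand N (W α) (T r)) ⟩
    ∑ R (λ α → N * N * (W α * W α) + (- (+ 2) * N * T r) * W α + T r * T r)
      ≡⟨ trans (∑-+ R _ _) (cong₂ _+_ (trans (∑-+ R _ _) (cong₂ _+_ (∑-*ˡ R (N * N) _) (∑-*ˡ R (- (+ 2) * N * T r) W))) (∑-const R (T r * T r))) ⟩
    N * N * ∑ R (λ α → W α * W α) + (- (+ 2) * N * T r) * ∑ R W + N * (T r * T r)
      ≡⟨ cong (λ t → N * N * ∑ R (λ α → W α * W α) + (- (+ 2) * N * T r) * t + N * (T r * T r)) (∑-walks r zeros zeros∈R) ⟩
    N * N * ∑ R (λ α → W α * W α) + (- (+ 2) * N * T r) * T r + N * (T r * T r)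
      ≡⟨ collect N (∑ R (λ α → W α * W α)) (T r) ⟩
    N * N * ∑ R (λ α → W α * W α) - N * (T r * T r)
      ≤⟨ i-j≤i _ _ {{nonNegative (*-nonNeg {N} (+≤+ ℕ.z≤n) (square-nonNeg (T r)))}} ⟩
    N * N * ∑ R (λ α → W α * W α)
      ≤⟨ *-monoˡ-≤-nonNeg (N * N) {{nonNegative (square-nonNeg N)}} ∑W²≤T² ⟩
    N * N * (T r * T r) ∎
    where
    open ≤-Reasoning
    W : List ℕ → ℤ
    W = walks r zeros
    expand : ∀ n w t → (n * w - t) * (n * w - t) ≡ n * n * (w * w) + (- (+ 2) * n * t) * w + t * t
    expand = solve-∀
    collect : ∀ n s t → n * n * s + (- (+ 2) * n * t) * t + n * (t * t) ≡ n * n * s - n * (t * t)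
    collect = solve-∀
    ∑W²≤T² : ∑ R (λ α → W α * W α) ≤ T r * T r
    ∑W²≤T² = begin
      ∑ R (λ α → W α * W α) ≤⟨ ∑-mono-≤ R (λ α α∈ → *-monoˡ-≤-nonNeg (W α) {{nonNegative (walks-nonNeg r zeros α)}} (W≤T α α∈)) ⟩
      ∑ R (λ α → W α * T r) ≡⟨ ∑-*ʳ R (T r) W ⟩
      ∑ R W * T r           ≡⟨ cong (_* T r) (∑-walks r zeros zeros∈R) ⟩
      T r * T r             ∎
      where
      W≤T : ∀ α → α ∈ R → W α ≤ T r
      W≤T α α∈ = ≤-trans (≤-∑ R (λ β _ → walks-nonNeg r zeros β) α∈) (≤-reflexive (∑-walks r zeros zeros∈R))

  energy-nonNeg : ∀ n → 0ℤ ≤ energy n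
  energy-nonNeg n = ∑-nonNeg R (λ α _ → square-nonNeg (error n α))

  module _ (H' : ℕ) (2B²≤NH : + 2 * (B * B) ≤ N * + suc H') where

    H : ℤ
    H = + suc H'

    -- 1 − N/B² ≤ (1 − 1/H)², as the gap is H·(N·H − 2B²) + B².
    decay-factor : (B * B - N) * (H * H) ≤ (+ H' * + H') * (B * B)
    decay-factor = 0≤i-j⇒j≤i (subst (0ℤ ≤_) (gap (+ H') N (B * B)) slack≥0)
      where
      gap : ∀ x n b → (1ℤ + x) * (n * (1ℤ + x) - + 2 * b) + b ≡ x * x * b - (b - n) * ((1ℤ + x) * (1ℤ + x))
      gap = solve-∀
      slack≥0 : 0ℤ ≤ H * (N * H - + 2 * (B * B)) + B * B
      slack≥0 = +-mono-≤ (*-nonNeg {H} (+≤+ ℕ.z≤n) (i≤j⇒0≤j-i 2B²≤NH)) (square-nonNeg B)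

    energy-decay : ∀ q r → energy (r ℕ.+ q ℕ.* d) * (H ^ q * H ^ q) ≤ ((+ H') ^ q * B ^ q) * ((+ H') ^ q * B ^ q) * (N * N * (T r * T r))
    energy-decay ℕ.zero    r = begin
      energy (r ℕ.+ 0) * (1ℤ * 1ℤ)    ≡⟨ cong (λ m → energy m * (1ℤ * 1ℤ)) (ℕP.+-identityʳ r) ⟩
      energy r * (1ℤ * 1ℤ)            ≡⟨ *-identityʳ (energy r) ⟩
      energy r                        ≤⟨ energy-initial r ⟩
      N * N * (T r * T r)             ≡⟨ *-identityˡ _ ⟨
      1ℤ * 1ℤ * (N * N * (T r * T r)) ∎
      where open ≤-Reasoning
    energy-decay (ℕ.suc q) r = begin
      energy (r ℕ.+ ℕ.suc q ℕ.* d) * (H ^ ℕ.suc q * H ^ ℕ.suc q)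
        ≡⟨ cong₂ (λ m h → energy m * h) (shift r q d) (pull-H H (H ^ q)) ⟩
      energy (m ℕ.+ d) * (H * H * (H ^ q * H ^ q))
        ≤⟨ *-monoʳ-≤-nonNeg (H * H * (H ^ q * H ^ q)) {{nonNegative (*-nonNeg (square-nonNeg H) (square-nonNeg (H ^ q)))}} (energy-+d m) ⟩
      (B * B - N) * energy m * (H * H * (H ^ q * H ^ q))
        ≡⟨ regroup (B * B - N) (energy m) (H * H) (H ^ q * H ^ q) ⟩
      (B * B - N) * (H * H) * (energy m * (H ^ q * H ^ q))
        ≤⟨ *-monoʳ-≤-nonNeg (energy m * (H ^ q * H ^ q)) {{nonNegative (*-nonNeg (energy-nonNeg m) (square-nonNeg (H ^ q)))}} decay-factor ⟩
      (+ H' * + H') * (B * B) * (energy m * (H ^ q * H ^ q))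
        ≤⟨ *-monoˡ-≤-nonNeg ((+ H' * + H') * (B * B)) {{nonNegative (*-nonNeg (square-nonNeg (+ H')) (square-nonNeg B))}} (energy-decay q r) ⟩
      (+ H' * + H') * (B * B) * (((+ H') ^ q * B ^ q) * ((+ H') ^ q * B ^ q) * (N * N * (T r * T r)))
        ≡⟨ push-H' (+ H') B ((+ H') ^ q) (B ^ q) (N * N * (T r * T r)) ⟩
      ((+ H') ^ ℕ.suc q * B ^ ℕ.suc q) * ((+ H') ^ ℕ.suc q * B ^ ℕ.suc q) * (N * N * (T r * T r)) ∎
      where
      open ≤-Reasoning
      m : ℕ
      m = r ℕ.+ q ℕ.* d
      shift : ∀ r q d → r ℕ.+ ℕ.suc q ℕ.* d ≡ r ℕ.+ q ℕ.* d ℕ.+ d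
      shift = NatSolver.solve-∀
      pull-H : ∀ h g → h * g * (h * g) ≡ h * h * (g * g)
      pull-H = solve-∀
      regroup : ∀ a e h g → a * e * (h * g) ≡ a * h * (e * g)
      regroup = solve-∀
      push-H' : ∀ x b xq bq z → x * x * (b * b) * (xq * bq * (xq * bq) * z) ≡ x * xq * (b * bq) * (x * xq * (b * bq)) * z
      push-H' = solve-∀

    error-bound : ∀ n α → α ∈ R →
      (error n α * H ^ (n ℕ./ d)) * (error n α * H ^ (n ℕ./ d)) ≤ ((+ H') ^ (n ℕ./ d) * (N * T n)) * ((+ H') ^ (n ℕ./ d) * (N * T n))
    error-bound n α α∈ = begin
      (error n α * H ^ q) * (error n α * H ^ q)
        ≡⟨ square-* (error n α) (H ^ q) ⟩
      error n α * error n α * (H ^ q * H ^ q)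
        ≤⟨ *-monoʳ-≤-nonNeg (H ^ q * H ^ q) {{nonNegative (square-nonNeg (H ^ q))}} (≤-∑ R (λ β _ → square-nonNeg (error n β)) α∈) ⟩
      energy n * (H ^ q * H ^ q)
        ≡⟨ cong (λ m → energy m * (H ^ q * H ^ q)) n≡r+q*d ⟩
      energy (r ℕ.+ q ℕ.* d) * (H ^ q * H ^ q)
        ≤⟨ energy-decay q r ⟩
      ((+ H') ^ q * B ^ q) * ((+ H') ^ q * B ^ q) * (N * N * (T r * T r))
        ≡⟨ rearrange ((+ H') ^ q) (B ^ q) N (T r) ⟩
      ((+ H') ^ q * (N * (T r * B ^ q))) * ((+ H') ^ q * (N * (T r * B ^ q)))
        ≡⟨ cong (λ t → ((+ H') ^ q * (N * t)) * ((+ H') ^ q * (N * t))) T-n ⟩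
      ((+ H') ^ q * (N * T n)) * ((+ H') ^ q * (N * T n)) ∎
      where
      open ≤-Reasoning
      q r : ℕ
      q = n ℕ./ d
      r = n ℕ.% d
      n≡r+q*d : n ≡ r ℕ.+ q ℕ.* d
      n≡r+q*d = m≡m%n+[m/n]*n n d
      square-* : ∀ a b → a * b * (a * b) ≡ a * a * (b * b)
      square-* = solve-∀
      rearrange : ∀ x b n t → x * b * (x * b) * (n * n * (t * t)) ≡ x * (n * (t * b)) * (x * (n * (t * b)))
      rearrange = solve-∀
      T-n : T r * B ^ q ≡ T n
      T-n = begin-equality
        T r * B ^ q             ≡⟨ cong (T r *_) (sym (pos-^ (k ℕ.^ d) q)) ⟩
        T r * + (k ℕ.^ d) ℕ.^ q ≡⟨ cong (λ e → T r * + e) (trans (ℕP.^-*-assoc k d q) (cong (k ℕ.^_) (ℕP.*-comm d q))) ⟩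
        T r * T (q ℕ.* d)       ≡⟨ T-+ r (q ℕ.* d) ⟨
        T (r ℕ.+ q ℕ.* d)       ≡⟨ cong T n≡r+q*d ⟨
        T n                     ∎

module Fraction where

  open import Data.Integer as ℤ using (ℤ; +_)
  import Data.Integer.Properties as ℤP
  open import Data.Nat as ℕ using (ℕ; zero; suc)
  open import Data.Rational as ℚ using (ℚ; _/_; 0ℚ; 1ℚ; _+_; _*_; _≤_; toℚᵘ)
  import Data.Nat.Properties as ℕP
  import Data.Rational.Properties as ℚP
  open import Data.Rational.Unnormalised as ℚᵘ using (mkℚᵘ; *≤*)
  import Data.Rational.Unnormalised.Properties as ℚᵘP
  open import Relation.Binary.PropositionalEquality
  open import Defs using (natRatio)
  open import Data.Product using (_×_; _,_; ∃-syntax)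

  toℚᵘ-/ : ∀ i b → toℚᵘ (i / suc b) ℚᵘ.≃ mkℚᵘ i b
  toℚᵘ-/ i b = ℚP.toℚᵘ-fromℚᵘ (mkℚᵘ i b)

  /-mono-≤ : ∀ i j a b → i ℤ.* + suc b ℤ.≤ j ℤ.* + suc a → i / suc a ℚ.≤ j / suc b
  /-mono-≤ i j a b ib≤ja = ℚP.toℚᵘ-cancel-≤ (ℚᵘP.≤-respˡ-≃ (ℚᵘP.≃-sym (toℚᵘ-/ i a)) (ℚᵘP.≤-respʳ-≃ (ℚᵘP.≃-sym (toℚᵘ-/ j b)) (*≤* ib≤ja)))

  /-cong : ∀ i j a b → i ℤ.* + suc b ≡ j ℤ.* + suc a → i / suc a ≡ j / suc b
  /-cong i j a b ib≡ja = ℚP.≤-antisym (/-mono-≤ i j a b (ℤP.≤-reflexive ib≡ja)) (/-mono-≤ j i b a (ℤP.≤-reflexive (sym ib≡ja)))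

  /-*-/ : ∀ i j a b → (i / suc a) ℚ.* (j / suc b) ≡ (i ℤ.* j) / (suc a ℕ.* suc b)
  /-*-/ i j a b = ℚP.toℚᵘ-injective (ℚᵘP.≃-trans (ℚP.toℚᵘ-homo-* (i / suc a) (j / suc b))
    (ℚᵘP.≃-trans (ℚᵘP.*-cong (toℚᵘ-/ i a) (toℚᵘ-/ j b)) (ℚᵘP.≃-sym (toℚᵘ-/ (i ℤ.* j) (b ℕ.+ a ℕ.* suc b)))))

  /-+-/ : ∀ i j a b → (i / suc a) ℚ.+ (j / suc b) ≡ (i ℤ.* + suc b ℤ.+ j ℤ.* + suc a) / (suc a ℕ.* suc b)
  /-+-/ i j a b = ℚP.toℚᵘ-injective (ℚᵘP.≃-trans (ℚP.toℚᵘ-homo-+ (i / suc a) (j / suc b))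
    (ℚᵘP.≃-trans (ℚᵘP.+-cong (toℚᵘ-/ i a) (toℚᵘ-/ j b)) (ℚᵘP.≃-sym (toℚᵘ-/ (i ℤ.* + suc b ℤ.+ j ℤ.* + suc a) (b ℕ.+ a ℕ.* suc b)))))

  -‿/ : ∀ i a → ℚ.- (i / suc a) ≡ (ℤ.- i) / suc a
  -‿/ i a = ℚP.toℚᵘ-injective (ℚᵘP.≃-trans (ℚP.toℚᵘ-homo‿- (i / suc a))
    (ℚᵘP.≃-trans (ℚᵘP.-‿cong (toℚᵘ-/ i a)) (ℚᵘP.≃-sym (toℚᵘ-/ (ℤ.- i) a))))

  ∣/∣ : ∀ i a → ℚ.∣ i / suc a ∣ ≡ (+ ℤ.∣ i ∣) / suc a
  ∣/∣ i a = ℚP.toℚᵘ-injective (ℚᵘP.≃-trans (ℚP.toℚᵘ-homo-∣-∣ (i / suc a))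
    (ℚᵘP.≃-trans (ℚᵘP.∣-∣-cong (toℚᵘ-/ i a)) (ℚᵘP.≃-sym (toℚᵘ-/ (+ ℤ.∣ i ∣) a))))

  /-nonNeg : ∀ n a → 0ℚ ℚ.≤ (+ n) / suc a
  /-nonNeg n a = /-mono-≤ (+ 0) (+ n) 0 a (subst (ℤ._≤ + n ℤ.* + 1) (sym (ℤP.*-zeroˡ (+ suc a))) (subst (+ 0 ℤ.≤_) (ℤP.pos-* n 1) (ℤ.+≤+ ℕ.z≤n)))

  ∣c/m-1/n∣≤ : ∀ c m n A a → ℤ.∣ + c ℤ.* + suc n ℤ.- + suc m ∣ ℕ.* suc a ℕ.≤ A ℕ.* (suc m ℕ.* suc n) →
               ℚ.∣ (+ c) / suc m ℚ.- (+ 1) / suc n ∣ ℚ.≤ (+ A) / suc a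
  ∣c/m-1/n∣≤ c m n A a cross≤ = begin
    ℚ.∣ (+ c) / suc m ℚ.+ ℚ.- ((+ 1) / suc n) ∣    ≡⟨ cong (λ z → ℚ.∣ (+ c) / suc m ℚ.+ z ∣) (-‿/ (+ 1) n) ⟩
    ℚ.∣ (+ c) / suc m ℚ.+ (ℤ.- + 1) / suc n ∣      ≡⟨ cong ℚ.∣_∣ (/-+-/ (+ c) (ℤ.- + 1) m n) ⟩
    ℚ.∣ X / (suc m ℕ.* suc n) ∣                    ≡⟨ ∣/∣ X (n ℕ.+ m ℕ.* suc n) ⟩
    (+ ℤ.∣ X ∣) / (suc m ℕ.* suc n)                ≤⟨ /-mono-≤ (+ ℤ.∣ X ∣) (+ A) (n ℕ.+ m ℕ.* suc n) a cross≤ℤ ⟩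
    (+ A) / suc a                                  ∎
    where
    open ℚP.≤-Reasoning
    X : ℤ
    X = + c ℤ.* + suc n ℤ.+ (ℤ.- + 1) ℤ.* + suc m
    X≡ : X ≡ + c ℤ.* + suc n ℤ.- + suc m
    X≡ = cong (ℤ._+_ (+ c ℤ.* + suc n)) (ℤP.-1*i≡-i (+ suc m))
    cross≤ℤ : + ℤ.∣ X ∣ ℤ.* + suc a ℤ.≤ + A ℤ.* + (suc m ℕ.* suc n)
    cross≤ℤ = subst₂ ℤ._≤_ (ℤP.pos-* ℤ.∣ X ∣ (suc a)) (ℤP.pos-* A (suc m ℕ.* suc n))
                (ℤ.+≤+ (subst (λ z → ℤ.∣ z ∣ ℕ.* suc a ℕ.≤ A ℕ.* (suc m ℕ.* suc n)) (sym X≡) cross≤))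

  NonNeg : ℚ → Set
  NonNeg a = 0ℚ ≤ a

  *-nonNeg : ∀ {a b} → NonNeg a → NonNeg b → NonNeg (a * b)
  *-nonNeg {a} {b} 0≤a 0≤b = subst (_≤ a * b) (ℚP.*-zeroˡ b) (ℚP.*-monoʳ-≤-nonNeg b {{ℚ.nonNegative 0≤b}} 0≤a)

  *-monoˡ-≤ : ∀ {c a b} → NonNeg c → a ≤ b → c * a ≤ c * b
  *-monoˡ-≤ {c} 0≤c a≤b = ℚP.*-monoˡ-≤-nonNeg c {{ℚ.nonNegative 0≤c}} a≤b

  *-monoʳ-≤ : ∀ {c a b} → NonNeg c → a ≤ b → a * c ≤ b * c
  *-monoʳ-≤ {c} 0≤c a≤b = ℚP.*-monoʳ-≤-nonNeg c {{ℚ.nonNegative 0≤c}} a≤b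

  ι : ℕ → ℚ
  ι n = (+ n) / 1

  ι-nonNeg : ∀ n → NonNeg (ι n)
  ι-nonNeg n = /-nonNeg n 0

  ι-+ : ∀ m n → ι (m ℕ.+ n) ≡ ι m + ι n
  ι-+ m n = sym (trans (/-+-/ (+ m) (+ n) 0 0) (/-cong (+ m ℤ.* + 1 ℤ.+ + n ℤ.* + 1) (+ (m ℕ.+ n)) 0 0 eq))
    where
    eq : (+ m ℤ.* + 1 ℤ.+ + n ℤ.* + 1) ℤ.* + 1 ≡ + (m ℕ.+ n) ℤ.* + 1
    eq = cong (ℤ._* + 1) (trans (cong₂ ℤ._+_ (ℤP.*-identityʳ (+ m)) (ℤP.*-identityʳ (+ n))) (sym (ℤP.pos-+ m n)))

  ι-* : ∀ m n → ι (m ℕ.* n) ≡ ι m * ι n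
  ι-* m n = sym (trans (/-*-/ (+ m) (+ n) 0 0) (cong (_/ 1) (sym (ℤP.pos-* m n))))

  ι-mono-≤ : ∀ {m n} → m ℕ.≤ n → ι m ≤ ι n
  ι-mono-≤ {m} {n} m≤n = /-mono-≤ (+ m) (+ n) 0 0 (ℤP.*-monoʳ-≤-nonNeg (+ 1) (ℤ.+≤+ m≤n))

  ι-*-inverse : ∀ n → ι (suc n) * ((+ 1) / suc n) ≡ 1ℚ
  ι-*-inverse n = trans (/-*-/ (+ suc n) (+ 1) 0 n) (/-cong (+ suc n ℤ.* + 1) (+ 1) (n ℕ.+ 0 ℕ.* suc n) 0 eq)
    where
    eq : (+ suc n ℤ.* + 1) ℤ.* + 1 ≡ + 1 ℤ.* + (1 ℕ.* suc n)
    eq = trans (ℤP.*-identityʳ _) (trans (ℤP.*-identityʳ _) (sym (trans (ℤP.*-identityˡ _) (cong +_ (ℕP.*-identityˡ (suc n))))))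

  ι-*-1/ : ∀ m c → ι m * ((+ 1) / suc c) ≡ (+ m) / suc c
  ι-*-1/ m c = trans (/-*-/ (+ m) (+ 1) 0 c) (/-cong (+ m ℤ.* + 1) (+ m) (c ℕ.+ 0 ℕ.* suc c) c (cong₂ ℤ._*_ (ℤP.*-identityʳ (+ m)) (cong (λ x → + suc x) (sym (ℕP.+-identityʳ c)))))

  infixr 8 _^_
  _^_ : ℚ → ℕ → ℚ
  x ^ zero  = 1ℚ
  x ^ suc n = x * x ^ n

  ^-nonNeg : ∀ {x} n → NonNeg x → NonNeg (x ^ n)
  ^-nonNeg zero    _   = /-nonNeg 1 0
  ^-nonNeg (suc n) 0≤x = *-nonNeg 0≤x (^-nonNeg n 0≤x)

  /-^ : ∀ x y q → ∃[ a ] (suc y ℕ.^ q ≡ suc a × ((+ x) / suc y) ^ q ≡ (+ x ℕ.^ q) / suc a)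
  /-^ x y zero    = 0 , refl , refl
  /-^ x y (suc q) with a , y^q≡1+a , eq ← /-^ x y q =
    a ℕ.+ y ℕ.* suc a , cong (suc y ℕ.*_) y^q≡1+a ,
    trans (cong ((+ x) / suc y *_) eq) (trans (/-*-/ (+ x) (+ x ℕ.^ q) y a) (cong (_/ (suc y ℕ.* suc a)) (sym (ℤP.pos-* x (x ℕ.^ q)))))

  natRatio-≤ : ∀ a m b c → a ℕ.* suc c ℕ.≤ b ℕ.* m → natRatio a m ≤ (+ b) / suc c
  natRatio-≤ a zero    b c _     = /-nonNeg b c
  natRatio-≤ a (suc t) b c cross = /-mono-≤ (+ a) (+ b) t c (subst₂ ℤ._≤_ (ℤP.pos-* a (suc c)) (ℤP.pos-* b (suc t)) (ℤ.+≤+ cross))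

  natRatio-nonNeg : ∀ a m → NonNeg (natRatio a m)
  natRatio-nonNeg a zero    = ℚP.≤-refl
  natRatio-nonNeg a (suc t) = /-nonNeg a t

module ExpSeries where

  open import Data.Nat as ℕ using (ℕ; zero; suc)
  import Data.Nat.Properties as ℕP
  open import Data.Integer as ℤ using (+_)
  open import Data.Rational as ℚ using (ℚ; _/_; 0ℚ; 1ℚ; _+_; _*_; _≤_)
  import Data.Rational.Properties as ℚP
  open import Data.Rational.Solver using (module +-*-Solver)
  open import Relation.Binary.PropositionalEquality
  open import Defs using (expSum)
  open Fraction

  -- Defs hides the accumulator loop of expSum in a where clause. The meta `loop` is solved by
  -- unification against the unfolding of expSum, once the with-abstractions have turned all
  -- arguments of the hidden loop into variables.
  mutual
    loop : ℚ → ℕ → ℕ → ℕ → ℚ → ℚ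
    loop = _

    expSum-suc : ∀ M x → expSum (suc M) x ≡ 1ℚ + loop x (suc M) M 1 (1ℚ * x * ((+ 1) / 1))
    expSum-suc M x with 1ℚ * x * ((+ 1) / 1)
    ... | t with 1ℚ
    ... | o with suc M
    ... | P with 1
    ... | j = refl

  -- multichoose m j = (m + j - 1 choose j), the coefficient of hʲ in (1 - h)⁻ᵐ.
  multichoose : ℕ → ℕ → ℕ
  multichoose m       zero    = 1
  multichoose zero    (suc j) = 0
  multichoose (suc m) (suc j) = multichoose m (suc j) ℕ.+ multichoose (suc m) j

  mutual
    suc-*-multichoose : ∀ j m → suc j ℕ.* multichoose m (suc j) ≡ (m ℕ.+ j) ℕ.* multichoose m j
    suc-*-multichoose j zero    = trans (ℕP.*-zeroʳ (suc j)) (sym (zero-multichoose j))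
      where
      zero-multichoose : ∀ j → j ℕ.* multichoose 0 j ≡ 0
      zero-multichoose zero    = refl
      zero-multichoose (suc j) = ℕP.*-zeroʳ (suc j)
    suc-*-multichoose j (suc m) = begin
      suc j ℕ.* (multichoose m (suc j) ℕ.+ multichoose (suc m) j)            ≡⟨ ℕP.*-distribˡ-+ (suc j) (multichoose m (suc j)) (multichoose (suc m) j) ⟩
      suc j ℕ.* multichoose m (suc j) ℕ.+ suc j ℕ.* multichoose (suc m) j    ≡⟨ cong (ℕ._+ suc j ℕ.* multichoose (suc m) j) (suc-*-multichoose j m) ⟩
      (m ℕ.+ j) ℕ.* multichoose m j ℕ.+ suc j ℕ.* multichoose (suc m) j      ≡⟨ cong (ℕ._+ suc j ℕ.* multichoose (suc m) j) (multichoose-suc j m) ⟨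
      m ℕ.* multichoose (suc m) j ℕ.+ suc j ℕ.* multichoose (suc m) j        ≡⟨ ℕP.*-distribʳ-+ (multichoose (suc m) j) m (suc j) ⟨
      (m ℕ.+ suc j) ℕ.* multichoose (suc m) j                                ≡⟨ cong (ℕ._* multichoose (suc m) j) (ℕP.+-suc m j) ⟩
      (suc m ℕ.+ j) ℕ.* multichoose (suc m) j                                ∎
      where open ≡-Reasoning

    multichoose-suc : ∀ j m → m ℕ.* multichoose (suc m) j ≡ (m ℕ.+ j) ℕ.* multichoose m j
    multichoose-suc zero    m = cong (ℕ._* 1) (sym (ℕP.+-identityʳ m))
    multichoose-suc (suc j) m = begin
      m ℕ.* (multichoose m (suc j) ℕ.+ multichoose (suc m) j)            ≡⟨ ℕP.*-distribˡ-+ m (multichoose m (suc j)) (multichoose (suc m) j) ⟩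
      m ℕ.* multichoose m (suc j) ℕ.+ m ℕ.* multichoose (suc m) j        ≡⟨ cong (m ℕ.* multichoose m (suc j) ℕ.+_) (multichoose-suc j m) ⟩
      m ℕ.* multichoose m (suc j) ℕ.+ (m ℕ.+ j) ℕ.* multichoose m j      ≡⟨ cong (m ℕ.* multichoose m (suc j) ℕ.+_) (suc-*-multichoose j m) ⟨
      m ℕ.* multichoose m (suc j) ℕ.+ suc j ℕ.* multichoose m (suc j)    ≡⟨ ℕP.*-distribʳ-+ (multichoose m (suc j)) m (suc j) ⟨
      (m ℕ.+ suc j) ℕ.* multichoose m (suc j)                            ∎
      where open ≡-Reasoning

  module NegativeBinomial (h : ℚ) (0≤h : NonNeg h) where
    open +-*-Solver

    term : ℕ → ℕ → ℚ
    term m j = ι (multichoose m j) * h ^ j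

    term-nonNeg : ∀ m j → NonNeg (term m j)
    term-nonNeg m j = *-nonNeg (ι-nonNeg (multichoose m j)) (^-nonNeg j 0≤h)

    partialSum : ℕ → ℕ → ℚ
    partialSum m zero    = 0ℚ
    partialSum m (suc N) = partialSum m N + term m N

    term-pascal : ∀ m j → term (suc m) (suc j) ≡ term m (suc j) + h * term (suc m) j
    term-pascal m j = trans (cong (_* (h * h ^ j)) (ι-+ (multichoose m (suc j)) (multichoose (suc m) j)))
      (solve 4 (λ a b c e → (a :+ b) :* (c :* e) := a :* (c :* e) :+ c :* (b :* e)) refl
         (ι (multichoose m (suc j))) (ι (multichoose (suc m) j)) h (h ^ j))

    partialSum-pascal : ∀ m N → partialSum (suc m) (suc N) ≡ partialSum m (suc N) + h * partialSum (suc m) N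
    partialSum-pascal m zero    = solve 2 (λ a c → con 0ℚ :+ a := (con 0ℚ :+ a) :+ c :* con 0ℚ) refl (term (suc m) 0) h
    partialSum-pascal m (suc N) = begin
      partialSum (suc m) (suc N) + term (suc m) (suc N)
        ≡⟨ cong₂ _+_ (partialSum-pascal m N) (term-pascal m N) ⟩
      (partialSum m (suc N) + h * partialSum (suc m) N) + (term m (suc N) + h * term (suc m) N)
        ≡⟨ solve 5 (λ a b c e f → (a :+ c :* b) :+ (e :+ c :* f) := (a :+ e) :+ c :* (b :+ f)) refl
             (partialSum m (suc N)) (partialSum (suc m) N) h (term m (suc N)) (term (suc m) N) ⟩
      (partialSum m (suc N) + term m (suc N)) + h * (partialSum (suc m) N + term (suc m) N) ∎
      where open ≡-Reasoning

    partialSum-zero : ∀ N → partialSum 0 (suc N) ≡ 1ℚ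
    partialSum-zero zero    = refl
    partialSum-zero (suc N) = trans (cong₂ _+_ (partialSum-zero N) (ℚP.*-zeroˡ (h ^ suc N))) (ℚP.+-identityʳ 1ℚ)

    -- 1 + hλ ≤ λ says λ ≥ (1 - h)⁻¹, and partial sums of (1 - h)⁻ᵐ are then at most λᵐ.
    partialSum≤ : ∀ {λ'} → NonNeg λ' → 1ℚ + h * λ' ≤ λ' → ∀ m N → partialSum m N ≤ λ' ^ m
    partialSum≤ 0≤λ 1+hλ≤λ zero    zero    = /-nonNeg 1 0
    partialSum≤ 0≤λ 1+hλ≤λ zero    (suc N) = ℚP.≤-reflexive (partialSum-zero N)
    partialSum≤ 0≤λ 1+hλ≤λ (suc m) zero    = ^-nonNeg (suc m) 0≤λ
    partialSum≤ {λ'} 0≤λ 1+hλ≤λ (suc m) (suc N) = begin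
      partialSum (suc m) (suc N)                    ≡⟨ partialSum-pascal m N ⟩
      partialSum m (suc N) + h * partialSum (suc m) N ≤⟨ ℚP.+-mono-≤ (partialSum≤ 0≤λ 1+hλ≤λ m (suc N)) (*-monoˡ-≤ 0≤h (partialSum≤ 0≤λ 1+hλ≤λ (suc m) N)) ⟩
      λ' ^ m + h * (λ' * λ' ^ m)                    ≡⟨ solve 3 (λ a c l → a :+ c :* (l :* a) := a :* (con 1ℚ :+ c :* l)) refl (λ' ^ m) h λ' ⟩
      λ' ^ m * (1ℚ + h * λ')                        ≤⟨ *-monoˡ-≤ (^-nonNeg m 0≤λ) 1+hλ≤λ ⟩
      λ' ^ m * λ'                                   ≡⟨ ℚP.*-comm (λ' ^ m) λ' ⟩
      λ' ^ suc m                                    ∎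
      where open ℚP.≤-Reasoning

    module _ {x : ℚ} (0≤x : NonNeg x) {m : ℕ} (x≤mh : x ≤ ι m * h) where

      term-ratio : ∀ j → term m j * x * ((+ 1) / suc j) ≤ term m (suc j)
      term-ratio j = begin
        term m j * x * c
          ≤⟨ *-monoʳ-≤ (/-nonNeg 1 j) (*-monoˡ-≤ (term-nonNeg m j) (ℚP.≤-trans x≤mh (*-monoʳ-≤ 0≤h (ι-mono-≤ (ℕP.m≤m+n m j))))) ⟩
        term m j * (ι (m ℕ.+ j) * h) * c
          ≡⟨ solve 5 (λ b q a e f → b :* q :* (a :* e) :* f := (a :* b) :* f :* (e :* q)) refl
               (ι (multichoose m j)) (h ^ j) (ι (m ℕ.+ j)) h c ⟩
        ι (m ℕ.+ j) * ι (multichoose m j) * c * h ^ suc j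
          ≡⟨ cong (λ z → z * c * h ^ suc j) (trans (sym (ι-* (m ℕ.+ j) (multichoose m j)))
                                            (trans (cong ι (sym (suc-*-multichoose j m))) (ι-* (suc j) (multichoose m (suc j))))) ⟩
        ι (suc j) * ι (multichoose m (suc j)) * c * h ^ suc j
          ≡⟨ solve 4 (λ a b e q → a :* b :* e :* q := b :* (a :* e) :* q) refl (ι (suc j)) (ι (multichoose m (suc j))) c (h ^ suc j) ⟩
        ι (multichoose m (suc j)) * (ι (suc j) * c) * h ^ suc j
          ≡⟨ cong (λ z → ι (multichoose m (suc j)) * z * h ^ suc j) (ι-*-inverse j) ⟩
        ι (multichoose m (suc j)) * 1ℚ * h ^ suc j
          ≡⟨ cong (_* h ^ suc j) (ℚP.*-identityʳ (ι (multichoose m (suc j)))) ⟩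
        term m (suc j) ∎
        where
        open ℚP.≤-Reasoning
        c : ℚ
        c = (+ 1) / suc j

      loop+partialSum≤ : ∀ P n j t → t ≤ term m j → loop x P n j t + partialSum m j ≤ partialSum m (n ℕ.+ j)
      loop+partialSum≤ P zero    j t t≤ = ℚP.≤-reflexive (ℚP.+-identityˡ (partialSum m j))
      loop+partialSum≤ P (suc n) j t t≤ = begin
        (t + loop x P n (suc j) t') + partialSum m j   ≡⟨ solve 3 (λ a g s → (a :+ g) :+ s := g :+ (s :+ a)) refl t (loop x P n (suc j) t') (partialSum m j) ⟩
        loop x P n (suc j) t' + (partialSum m j + t)   ≤⟨ ℚP.+-monoʳ-≤ (loop x P n (suc j) t') (ℚP.+-monoʳ-≤ (partialSum m j) t≤) ⟩
        loop x P n (suc j) t' + partialSum m (suc j)   ≤⟨ loop+partialSum≤ P n (suc j) t' t'≤ ⟩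
        partialSum m (n ℕ.+ suc j)                     ≡⟨ cong (partialSum m) (ℕP.+-suc n j) ⟩
        partialSum m (suc n ℕ.+ j)                     ∎
        where
        open ℚP.≤-Reasoning
        t' : ℚ
        t' = t * x * ((+ 1) / suc j)
        t'≤ : t' ≤ term m (suc j)
        t'≤ = ℚP.≤-trans (*-monoʳ-≤ (/-nonNeg 1 j) (*-monoʳ-≤ 0≤x t≤)) (term-ratio j)

      expSum≤partialSum : ∀ N → expSum N x ≤ partialSum m N
      expSum≤partialSum zero    = ℚP.≤-refl
      expSum≤partialSum (suc N) = begin
        expSum (suc N) x                 ≡⟨ expSum-suc N x ⟩
        1ℚ + loop x (suc N) N 1 t₁       ≡⟨ ℚP.+-comm 1ℚ (loop x (suc N) N 1 t₁) ⟩
        loop x (suc N) N 1 t₁ + partialSum m 1 ≤⟨ loop+partialSum≤ (suc N) N 1 t₁ (term-ratio 0) ⟩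
        partialSum m (N ℕ.+ 1)           ≡⟨ cong (partialSum m) (ℕP.+-comm N 1) ⟩
        partialSum m (suc N)             ∎
        where
        open ℚP.≤-Reasoning
        t₁ : ℚ
        t₁ = 1ℚ * x * ((+ 1) / 1)

module Discrepancy (k c₀ : ℕ) (cs : List ℕ) (p-prime : Prime (suc k)) (2<p : 2 < suc k) (p∤c₀ : ¬ (suc k ∣ c₀)) where

  open import Data.Integer as ℤ using (ℤ; +_; _*_; _-_)
  open ListSum using (square-nonNeg)
  import Data.Integer.Properties as ℤP
  open import Data.List using (length)
  open import Data.List.Membership.Propositional using (_∈_)
  import Data.Nat as ℕ
  import Data.Nat.Properties as ℕP
  import Data.Rational.Properties as ℚP
  open import Data.Product using (_,_; ∃-syntax)
  open import Data.Rational as ℚ using (_/_)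
  open import Relation.Binary.PropositionalEquality
  open import Relation.Nullary using (yes; no; contradiction)
  open import Defs using (countA; discrepancy; natRatio)
  open Fraction
  open Modular k using (p)
  open HornerStep k c₀ cs using (d; c; zeros)
  open Walks k c₀ cs
  open Energy k c₀ cs p-prime 2<p p∤c₀

  square-cancel-≤ : ∀ m n → m ℕ.* m ℕ.≤ n ℕ.* n → m ℕ.≤ n
  square-cancel-≤ m n m²≤n² with m ℕ.≤? n
  ... | yes m≤n = m≤n
  ... | no  m≰n = contradiction m²≤n² (ℕP.<⇒≱ (ℕP.*-mono-< (ℕP.≰⇒> m≰n) (ℕP.≰⇒> m≰n)))

  ∣∣-mono-≤ : ∀ {i j} → ℤ.0ℤ ℤ.≤ i → i ℤ.≤ j → ℤ.∣ i ∣ ℕ.≤ ℤ.∣ j ∣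
  ∣∣-mono-≤ {i} {j} 0≤i i≤j = ℤP.drop‿+≤+ (subst₂ ℤ._≤_ (sym (ℤP.0≤i⇒+∣i∣≡i 0≤i)) (sym (ℤP.0≤i⇒+∣i∣≡i (ℤP.≤-trans 0≤i i≤j))) i≤j)

  ∣square∣ : ∀ i j → ℤ.∣ (i * j) * (i * j) ∣ ≡ (ℤ.∣ i ∣ ℕ.* ℤ.∣ j ∣) ℕ.* (ℤ.∣ i ∣ ℕ.* ℤ.∣ j ∣)
  ∣square∣ i j = trans (ℤP.abs-* (i * j) (i * j)) (cong₂ ℕ._*_ (ℤP.abs-* i j) (ℤP.abs-* i j))

  1≤⇒≡suc : ∀ m → 1 ℕ.≤ m → ∃[ t ] (m ≡ suc t)
  1≤⇒≡suc (suc t) _ = t , refl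

  module _ (H' : ℕ) (2B²≤NH : 2 ℕ.* (k ℕ.^ d ℕ.* k ℕ.^ d) ℕ.≤ p ℕ.^ d ℕ.* suc H') where

    ∣error∣-bound : ∀ n α → α ∈ R → ℤ.∣ error n α ∣ ℕ.* suc H' ℕ.^ (n ℕ./ d) ℕ.≤ H' ℕ.^ (n ℕ./ d) ℕ.* (p ℕ.^ d ℕ.* k ℕ.^ n)
    ∣error∣-bound n α α∈ = square-cancel-≤ _ _ (subst₂ ℕ._≤_ lhs rhs (∣∣-mono-≤ (square-nonNeg (error n α * (+ suc H') ℤ.^ q)) (error-bound H' 2B²≤NHℤ n α α∈)))
      where
      q : ℕ
      q = n ℕ./ d
      2B²≤NHℤ : + 2 * (B * B) ℤ.≤ N * + suc H'
      2B²≤NHℤ = subst₂ ℤ._≤_ (trans (ℤP.pos-* 2 (k ℕ.^ d ℕ.* k ℕ.^ d)) (cong (+ 2 *_) (ℤP.pos-* (k ℕ.^ d) (k ℕ.^ d))))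
                             (trans (cong (λ m → + (m ℕ.* suc H')) (sym length-R)) (ℤP.pos-* (length R) (suc H')))
                             (ℤ.+≤+ 2B²≤NH)
      lhs : ℤ.∣ (error n α * (+ suc H') ℤ.^ q) * (error n α * (+ suc H') ℤ.^ q) ∣ ≡ (ℤ.∣ error n α ∣ ℕ.* suc H' ℕ.^ q) ℕ.* (ℤ.∣ error n α ∣ ℕ.* suc H' ℕ.^ q)
      lhs = trans (∣square∣ (error n α) _) (cong (λ x → (ℤ.∣ error n α ∣ ℕ.* x) ℕ.* (ℤ.∣ error n α ∣ ℕ.* x)) (cong ℤ.∣_∣ (sym (pos-^ (suc H') q))))
      rhs : ℤ.∣ ((+ H') ℤ.^ q * (N * T n)) * ((+ H') ℤ.^ q * (N * T n)) ∣ ≡ (H' ℕ.^ q ℕ.* (p ℕ.^ d ℕ.* k ℕ.^ n)) ℕ.* (H' ℕ.^ q ℕ.* (p ℕ.^ d ℕ.* k ℕ.^ n))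
      rhs = trans (∣square∣ ((+ H') ℤ.^ q) (N * T n))
                  (cong₂ (λ x y → (x ℕ.* y) ℕ.* (x ℕ.* y)) (cong ℤ.∣_∣ (sym (pos-^ H' q))) (trans (ℤP.abs-* N (T n)) (cong (ℕ._* k ℕ.^ n) length-R)))

    discrepancy≤ : ∀ n α → α ∈ R → discrepancy p n d c α ℚ.≤ ((+ H') / suc H') ^ (n ℕ./ d)
    discrepancy≤ n α α∈
      with t , k^n≡1+t ← 1≤⇒≡suc (k ℕ.^ n) (ℕP.m^n>0 k {{ℕ.>-nonZero 1≤k}} n)
         | u , p^d≡1+u ← 1≤⇒≡suc (p ℕ.^ d) (ℕP.m^n>0 p d)
         | a , H^q≡1+a , μ^q≡ ← /-^ H' H' (n ℕ./ d) = begin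
      ℚ.∣ natRatio C (k ℕ.^ n) ℚ.- natRatio 1 (p ℕ.^ d) ∣
        ≡⟨ cong₂ (λ x y → ℚ.∣ natRatio C x ℚ.- natRatio 1 y ∣) k^n≡1+t p^d≡1+u ⟩
      ℚ.∣ (+ C) / suc t ℚ.- (+ 1) / suc u ∣
        ≤⟨ ∣c/m-1/n∣≤ C t u (H' ℕ.^ q) a cross ⟩
      (+ H' ℕ.^ q) / suc a
        ≡⟨ μ^q≡ ⟨
      ((+ H') / suc H') ^ q ∎
      where
      open ℚP.≤-Reasoning
      q : ℕ
      q = n ℕ./ d
      C : ℕ
      C = countA p n c α
      error≡ : error n α ≡ + C * + suc u - + suc t
      error≡ = trans (cong₂ (λ x y → + x * y - T n) (trans length-R p^d≡1+u) (sym (countA-walks n α)))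
                     (cong₂ _-_ (ℤP.*-comm (+ suc u) (+ C)) (cong +_ k^n≡1+t))
      cross : ℤ.∣ + C * + suc u - + suc t ∣ ℕ.* suc a ℕ.≤ H' ℕ.^ q ℕ.* (suc t ℕ.* suc u)
      cross = subst₂ (λ e x → ℤ.∣ e ∣ ℕ.* x ℕ.≤ H' ℕ.^ q ℕ.* (suc t ℕ.* suc u)) error≡ H^q≡1+a
                (subst (λ x → ℤ.∣ error n α ∣ ℕ.* suc H' ℕ.^ q ℕ.≤ H' ℕ.^ q ℕ.* x)
                       (trans (cong₂ ℕ._*_ p^d≡1+u k^n≡1+t) (ℕP.*-comm (suc u) (suc t)))
                       (∣error∣-bound n α α∈))

module DeltaBound where

  open import Data.Integer as ℤ using (+_; 1ℤ)
  open import Data.Integer.Tactic.RingSolver using (solve-∀)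
  open import Data.List using (List; []; _∷_; map; concatMap)
  open import Data.List.Relation.Unary.All as All using (All)
  import Data.List.Relation.Unary.All.Properties as All
  open import Data.Nat as ℕ using (ℕ; zero; suc; _+_; _*_; _≤_; _<_; s≤s; z≤n)
  import Data.Nat.Properties as ℕP
  open import Data.Nat.DivMod using (_/_; _%_; m≡m%n+[m/n]*n; m%n<n)
  open import Data.Nat.Divisibility using (_∣_; ∣⇒≤)
  open import Data.Nat.Primality using (Prime)
  import Data.Nat.Tactic.RingSolver as NatSolver
  open import Data.Product using (_,_)
  open import Data.Rational as ℚ using (ℚ; 0ℚ; 1ℚ)
  import Data.Rational.Properties as ℚP
  open import Relation.Binary.PropositionalEquality
  open import Relation.Nullary using (¬_)
  open import Relation.Nullary.Decidable using (toWitness)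
  open import Data.Rational.Solver using (module +-*-Solver)
  open import Defs
  open Enumeration using (∈-monicNotDivX⁻; ∈-nonzeros⁻)
  open Fraction
  open import Data.List.Membership.Propositional using (_∈_)
  open ExpSeries

  maxℚ-≤ : ∀ {Y} (L : List ℚ) → 0ℚ ℚ.≤ Y → All (ℚ._≤ Y) L → maxℚ L ℚ.≤ Y
  maxℚ-≤ []      0≤Y All.[]         = 0≤Y
  maxℚ-≤ (x ∷ L) 0≤Y (x≤Y All.∷ L≤Y) = ℚP.⊔-lub x≤Y (maxℚ-≤ L 0≤Y L≤Y)

  maxℚ-nonNeg : ∀ L → 0ℚ ℚ.≤ maxℚ L
  maxℚ-nonNeg []      = ℚP.≤-refl
  maxℚ-nonNeg (x ∷ L) = ℚP.≤-trans (maxℚ-nonNeg L) (ℚP.p≤q⊔p x (maxℚ L))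

  δ-nonNeg : ∀ p n d → 0ℚ ℚ.≤ δ p n d
  δ-nonNeg p n d = maxℚ-nonNeg (concatMap (λ c → map (discrepancy p n d c) (residues p d)) (monicNotDivX p d))

  six/five≤expSum3[1/3] : (+ 6) ℚ./ 5 ℚ.≤ expSum 3 ((+ 1) ℚ./ 3)
  six/five≤expSum3[1/3] = toWitness {a? = (+ 6) ℚ./ 5 ℚP.≤? expSum 3 ((+ 1) ℚ./ 3)} _

  module Rates (H'' : ℕ) where

    H' : ℕ
    H' = suc H''

    h μ ν : ℚ
    h = (+ 1) ℚ./ suc H'
    μ = (+ H') ℚ./ suc H'
    ν = (+ suc H') ℚ./ H'

    -- The cross-multiplied identities below are ring identities in + H'', since + suc m and
    -- 1ℤ + + m are definitionally equal.
    μ*ν≡1 : μ ℚ.* ν ≡ 1ℚ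
    μ*ν≡1 = trans (/-*-/ (+ H') (+ suc H') H' H'') (/-cong (+ H' ℤ.* + suc H') (+ 1) (H'' + H' * suc H'') 0 (cross (+ H'')))
      where
      cross : ∀ x → ((1ℤ ℤ.+ x) ℤ.* (1ℤ ℤ.+ (1ℤ ℤ.+ x))) ℤ.* + 1 ≡ + 1 ℤ.* ((1ℤ ℤ.+ (1ℤ ℤ.+ x)) ℤ.* (1ℤ ℤ.+ x))
      cross = solve-∀

    1+h*ν≡ν : 1ℚ ℚ.+ h ℚ.* ν ≡ ν
    1+h*ν≡ν = trans (cong (1ℚ ℚ.+_) (/-*-/ (+ 1) (+ suc H') H' H''))
                (trans (/-+-/ (+ 1) (+ 1 ℤ.* + suc H') 0 (H'' + H' * suc H''))
                       (/-cong (+ 1 ℤ.* + (suc H' * suc H'') ℤ.+ (+ 1 ℤ.* + suc H') ℤ.* + 1) (+ suc H') (H'' + H' * suc H'' + 0 * suc (H'' + H' * suc H'')) H'' (cross (+ H''))))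
      where
      cross : ∀ x → ((+ 1) ℤ.* ((1ℤ ℤ.+ (1ℤ ℤ.+ x)) ℤ.* (1ℤ ℤ.+ x)) ℤ.+ ((+ 1) ℤ.* (1ℤ ℤ.+ (1ℤ ℤ.+ x))) ℤ.* + 1) ℤ.* (1ℤ ℤ.+ x)
                  ≡ (1ℤ ℤ.+ (1ℤ ℤ.+ x)) ℤ.* (+ 1 ℤ.* ((1ℤ ℤ.+ (1ℤ ℤ.+ x)) ℤ.* (1ℤ ℤ.+ x)))
      cross = solve-∀

    μ^q*ν^[1+q]≡ν : ∀ q → μ ^ q ℚ.* ν ^ suc q ≡ ν
    μ^q*ν^[1+q]≡ν zero    = trans (ℚP.*-identityˡ (ν ^ 1)) (ℚP.*-identityʳ ν)
    μ^q*ν^[1+q]≡ν (suc q) = begin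
      (μ ℚ.* μ ^ q) ℚ.* (ν ℚ.* ν ^ suc q) ≡⟨ solve 4 (λ a b x y → (a :* x) :* (b :* y) := (a :* b) :* (x :* y)) refl μ ν (μ ^ q) (ν ^ suc q) ⟩
      (μ ℚ.* ν) ℚ.* (μ ^ q ℚ.* ν ^ suc q) ≡⟨ cong₂ ℚ._*_ μ*ν≡1 (μ^q*ν^[1+q]≡ν q) ⟩
      1ℚ ℚ.* ν                             ≡⟨ ℚP.*-identityˡ ν ⟩
      ν                                    ∎
      where
      open ≡-Reasoning
      open +-*-Solver

    ν≤6/5 : 4 ≤ H'' → ν ℚ.≤ (+ 6) ℚ./ 5
    ν≤6/5 4≤H'' = /-mono-≤ (+ suc H') (+ 6) H'' 4 (ℤ.+≤+ (begin
      suc H' * 5              ≡⟨ split H'' ⟩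
      4 + (5 * H'' + 6)       ≤⟨ ℕP.+-monoˡ-≤ (5 * H'' + 6) 4≤H'' ⟩
      H'' + (5 * H'' + 6)     ≡⟨ collect H'' ⟩
      6 * suc H''             ∎))
      where
      open ℕP.≤-Reasoning
      split : ∀ x → suc (suc x) * 5 ≡ 4 + (5 * x + 6)
      split = NatSolver.solve-∀
      collect : ∀ x → x + (5 * x + 6) ≡ 6 * suc x
      collect = NatSolver.solve-∀

  ∈-nonzeros⇒∤ : ∀ k {c₀} → c₀ ∈ nonzeros (suc k) → ¬ (suc k ∣ c₀)
  ∈-nonzeros⇒∤ k c₀∈ p∣c₀ with 0<c₀ , c₀<p ← ∈-nonzeros⁻ k c₀∈ = ℕP.<⇒≱ c₀<p (∣⇒≤ {{ℕ.>-nonZero 0<c₀}} p∣c₀)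

  discrepancy≤ : ∀ k d' n → Prime (suc k) → 2 < suc k → ∀ H' →
                 2 * (k ℕ.^ suc d' * k ℕ.^ suc d') ≤ suc k ℕ.^ suc d' * suc H' →
                 ∀ {c} → c ∈ monicNotDivX (suc k) (suc d') → ∀ {α} → α ∈ residues (suc k) (suc d') →
                 discrepancy (suc k) n (suc d') c α ℚ.≤ ((+ H') ℚ./ suc H') ^ (n / suc d')
  discrepancy≤ k d' n p-prime 2<p H' 2B²≤NH c∈ α∈
    with c₀ , cs , refl , c₀∈ , refl ← ∈-monicNotDivX⁻ (suc k) d' c∈ =
    Discrepancy.discrepancy≤ k c₀ cs p-prime 2<p (∈-nonzeros⇒∤ k c₀∈) H' 2B²≤NH n _ α∈

  δ≤ : ∀ k d' n → Prime (suc k) → 2 < suc k → ∀ H' →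
       2 * (k ℕ.^ suc d' * k ℕ.^ suc d') ≤ suc k ℕ.^ suc d' * suc H' →
       δ (suc k) n (suc d') ℚ.≤ ((+ H') ℚ./ suc H') ^ (n / suc d')
  δ≤ k d' n p-prime 2<p H' 2B²≤NH =
    maxℚ-≤ _ (^-nonNeg (n / suc d') (/-nonNeg H' H'))
      (All.concat⁺ (All.map⁺ (All.tabulate (λ c∈ → All.map⁺ (All.tabulate (λ α∈ → discrepancy≤ k d' n p-prime 2<p H' 2B²≤NH c∈ α∈))))))

  module Bound (k' d' n : ℕ) (p-prime : Prime (3 + k')) where

    k p d P H : ℕ
    k = 2 + k'
    p = suc k
    d = suc d'
    P = p ℕ.^ (d * d)
    H = suc d * P

    6≤H : 6 ≤ H
    6≤H = ℕP.*-mono-≤ {2} {suc d} {3} {P} (s≤s (s≤s z≤n)) (ℕP.≤-trans (s≤s (s≤s (s≤s z≤n))) (ℕP.^-monoʳ-≤ p {1} {d * d} (s≤s z≤n)))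

    H'' : ℕ
    H'' = H ℕ.∸ 2

    H≡ : H ≡ suc (suc H'')
    H≡ = sym (ℕP.m+[n∸m]≡n {2} {H} (ℕP.≤-trans (s≤s (s≤s z≤n)) 6≤H))

    open Rates H''

    2B²≤NH : 2 * (k ℕ.^ d * k ℕ.^ d) ≤ p ℕ.^ d * suc H'
    2B²≤NH = begin
      2 * (k ℕ.^ d * k ℕ.^ d)        ≤⟨ ℕP.*-mono-≤ {2} {suc d} (s≤s (s≤s z≤n)) (ℕP.*-mono-≤ k^d≤p^d (ℕP.≤-trans k^d≤p^d p^d≤P)) ⟩
      suc d * (p ℕ.^ d * P)          ≡⟨ x*[y*z]≡y*[x*z] (suc d) (p ℕ.^ d) P ⟩
      p ℕ.^ d * H                    ≡⟨ cong (p ℕ.^ d *_) H≡ ⟩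
      p ℕ.^ d * suc H'               ∎
      where
      open ℕP.≤-Reasoning
      k^d≤p^d : k ℕ.^ d ≤ p ℕ.^ d
      k^d≤p^d = ℕP.^-monoˡ-≤ d (ℕP.n≤1+n k)
      p^d≤P : p ℕ.^ d ≤ P
      p^d≤P = ℕP.^-monoʳ-≤ p (ℕP.m≤m*n d d)
      x*[y*z]≡y*[x*z] : ∀ x y z → x * (y * z) ≡ y * (x * z)
      x*[y*z]≡y*[x*z] = NatSolver.solve-∀

    q : ℕ
    q = n / d

    exponent : ℚ
    exponent = natRatio n ((d * d + d) * P)

    exponent≤[1+q]h : exponent ℚ.≤ ι (suc q) ℚ.* h
    exponent≤[1+q]h = subst (exponent ℚ.≤_) (sym (ι-*-1/ (suc q) H')) (natRatio-≤ n ((d * d + d) * P) (suc q) H' (begin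
      n * suc H'                   ≤⟨ ℕP.*-monoˡ-≤ (suc H') (ℕP.<⇒≤ n<[1+q]d) ⟩
      suc q * d * suc H'           ≡⟨ cong (λ x → suc q * d * x) (sym H≡) ⟩
      suc q * d * H                ≡⟨ regroup (suc q) d P ⟩
      suc q * ((d * d + d) * P)    ∎))
      where
      open ℕP.≤-Reasoning
      n<[1+q]d : n < suc q * d
      n<[1+q]d = begin-strict
        n                ≡⟨ m≡m%n+[m/n]*n n d ⟩
        n % d + q * d    <⟨ ℕP.+-monoˡ-< (q * d) (m%n<n n d) ⟩
        d + q * d        ∎
      regroup : ∀ a d P → a * d * (suc d * P) ≡ a * ((d * d + d) * P)
      regroup = NatSolver.solve-∀

    expSum≤ν^[1+q] : ∀ N → expSum N exponent ℚ.≤ ν ^ suc q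
    expSum≤ν^[1+q] N = ℚP.≤-trans (expSum≤partialSum (natRatio-nonNeg n ((d * d + d) * P)) exponent≤[1+q]h N)
                                  (partialSum≤ (/-nonNeg (suc H') H'') (ℚP.≤-reflexive 1+h*ν≡ν) (suc q) N)
      where open NegativeBinomial h (/-nonNeg 1 H')

    δ*expSum≤6/5 : ∀ N → δ p n d ℚ.* expSum N exponent ℚ.≤ (+ 6) ℚ./ 5
    δ*expSum≤6/5 N = begin
      δ p n d ℚ.* expSum N exponent ≤⟨ *-monoˡ-≤ (δ-nonNeg p n d) (expSum≤ν^[1+q] N) ⟩
      δ p n d ℚ.* ν ^ suc q         ≤⟨ *-monoʳ-≤ (^-nonNeg (suc q) (/-nonNeg (suc H') H'')) (δ≤ k d' n p-prime (s≤s (s≤s (s≤s z≤n))) H' 2B²≤NH) ⟩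
      μ ^ q ℚ.* ν ^ suc q           ≡⟨ μ^q*ν^[1+q]≡ν q ⟩
      ν                             ≤⟨ ν≤6/5 (ℕP.∸-monoˡ-≤ 2 6≤H) ⟩
      (+ 6) ℚ./ 5                   ∎
      where open ℚP.≤-Reasoning

open import Data.Empty using (⊥-elim)
open import Data.Nat using (_+_; _*_; _^_; _≤_; s≤s; nonTrivial⇒n>1)
open import Data.Nat.Divisibility using (∣-refl)
open import Data.Nat.Primality using (prime⇒nonTrivial)
open import Data.Integer using (+_)
open import Data.Product using (_,_)
open import Data.Rational using (_/_)
import Data.Rational as ℚ
import Data.Rational.Properties as ℚP
open import Defs
open DeltaBound using (module Bound; six/five≤expSum3[1/3])

theorem4p2 : ∀ (p n d : ℕ) → Prime p → ¬ (2 ∣ p) → 1 ≤ n → 1 ≤ d →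
    ExpLe (δ p n d) ((+ 1) / 3) (natRatio n ((d * d + d) * p ^ (d * d)))
theorem4p2 0 n d p-prime _ _ _ with () ← nonTrivial⇒n>1 0 {{prime⇒nonTrivial p-prime}}
theorem4p2 1 n d p-prime _ _ _ with s≤s () ← nonTrivial⇒n>1 1 {{prime⇒nonTrivial p-prime}}
theorem4p2 2 n d _ 2∤2 _ _ = ⊥-elim (2∤2 ∣-refl)
theorem4p2 (suc (suc (suc k'))) n (suc d') p-prime _ _ _ N ε 0<ε = 3 , (begin
  δ p n d ℚ.* expSum N exponent     ≤⟨ δ*expSum≤6/5 N ⟩
  (+ 6) / 5                         ≤⟨ six/five≤expSum3[1/3] ⟩
  expSum 3 ((+ 1) / 3)              ≡⟨ ℚP.+-identityʳ _ ⟨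
  expSum 3 ((+ 1) / 3) ℚ.+ ℚ.0ℚ     ≤⟨ ℚP.+-monoʳ-≤ _ (ℚP.<⇒≤ 0<ε) ⟩
  expSum 3 ((+ 1) / 3) ℚ.+ ε        ∎)
  where
  open ℚP.≤-Reasoning
  open Bound k' d' n p-prime
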